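{- Let $\mathcal{L}$ and $\mathcal{K}$ be finite meet-semilattices and let $\mathcal{L}\hookrightarrow\mathcal{K}$ be a consistent meet-semilattice order embedding (identify $\mathcal{L}$ with its image, so $\mathcal{L}$ and $\mathcal{K}$ share the minimum $\hat 0$). Then (1) $\mathbb{B}(\mathcal{L})=\{B\cap\mathcal{L}^+ : B\in\mathbb{B}(\mathcal{K}),\ I(\mathcal{L})\subseteq B\}$; (2) if $B\in\mathbb{B}(\mathcal{K})$ and $I(\mathcal{L})\subseteq B$, then $\mathcal{N}_{\mathcal{L}}(B\cap\mathcal{L}^+)\subseteq\mathcal{N}_{\mathcal{K}}(B)$.
   Context: All posets are finite. For a meet-semilattice $\mathcal{P}$ with minimum $\hat 0$, $\mathcal{P}^+=\mathcal{P}\setminus\{\hat 0\}$; $[x,y]=\{z:x\le z\le y\}$. A poset is irreducible if it is not isomorphic to a product of two posets each with at least two elements; $I(\mathcal{P})=\{x\in\mathcal{P}^+: [\hat 0,x]\text{ irreducible}\}$. For $B\subseteq\mathcal{P}$, $B_{\le x}=\{z\in B:z\le x\}$, and $\max B_{\le x}$ is its set of maximal elements. A building set of $\mathcal{P}$ is $B\subseteq\mathcal{P}^+$ such that for every $x\in\mathcal{P}^+$ with $\max B_{\le x}=\{x_1,\dots,x_k\}$, the map $\prod_{j}[\hat 0,x_j]\to[\hat 0,x]$, $(y_j)\mapsto y_1\vee\cdots\vee y_k$, is a poset isomorphism (joins computed in $\mathcal{P}$); $\mathbb{B}(\mathcal{P})$ denotes the set of building sets. For $B\in\mathbb{B}(\mathcal{P})$,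 a subset $N\subseteq B$ is nested if for every collection $x_1,\dots,x_t\in N$ with $t\ge 2$ of pairwise incomparable elements, the join $\bigvee_{i=1}^t x_i$ exists in $\mathcal{P}$ and does not belong to $B$; $\mathcal{N}_{\mathcal{P}}(B)$ is the simplicial complex of all nested sets of $B$ (joins taken in $\mathcal{P}$). A meet-semilattice order embedding $f:\mathcal{L}\to\mathcal{K}$ is a map with $x\le y\iff f(x)\le f(y)$ and $f(x\wedge^{\mathcal{L}}y)=f(x)\wedge^{\mathcal{K}}f(y)$ for all $x,y$ (it need not preserve joins). It is consistent if for every $x\in\mathcal{L}^+$, $I(\mathcal{K})_{\le_{\mathcal{K}}x}\subseteq I(\mathcal{L})_{\le_{\mathcal{L}}x}$. -}

module Defs where

open import Level using (0ℓ)
open import Data.Nat using (ℕ; _≤_)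
open import Data.Fin using (Fin)
open import Data.Fin.Subset using (Subset; _∈_; _∉_; _⊆_; ∣_∣)
open import Data.Product using (Σ; Σ-syntax; ∃; ∃-syntax; _×_; _,_; proj₁)
open import Relation.Nullary using (¬_)
open import Relation.Binary.Core using (Rel)
open import Relation.Binary.Definitions using (Decidable)
open import Relation.Binary.Structures using (IsPartialOrder)
open import Relation.Binary.Lattice.Structures using (IsMeetSemilattice)
open import Relation.Binary.PropositionalEquality using (_≡_; _≢_)

record FinPoset : Set₁ where
  field
    size           : ℕ
    _≼_            : Rel (Fin size) 0ℓ
    isPartialOrder : IsPartialOrder _≡_ _≼_

ProdOrder : (Q R : FinPoset) →
            Rel (Fin (FinPoset.size Q) × Fin (FinPoset.size R)) 0ℓ
ProdOrder Q R (a , b) (a' , b') =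
  FinPoset._≼_ Q a a' × FinPoset._≼_ R b b'

record FinMSL : Set₁ where
  field
    size              : ℕ
    _≼_               : Rel (Fin size) 0ℓ
    _≼?_              : Decidable _≼_
    _∧_               : Fin size → Fin size → Fin size
    isMeetSemilattice : IsMeetSemilattice _≡_ _≼_ _∧_
    𝟘                 : Fin size
    𝟘-min             : ∀ x → 𝟘 ≼ x

module _ (P : FinMSL) where
  open FinMSL P

  private
    El = Fin size

  IsJoin : (El → Set) → El → Set
  IsJoin S z = (∀ s → S s → s ≼ z) × (∀ u → (∀ s → S s → s ≼ u) → z ≼ u)

  record IsoOnto {A : Set} (_⊑_ : Rel A 0ℓ) (x : El) (f : A → El) : Set where
    field
      lands   : ∀ a → f a ≼ x
      mono    : ∀ a b → a ⊑ b → f a ≼ f b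
      reflect : ∀ a b → f a ≼ f b → a ⊑ b
      onto    : ∀ z → z ≼ x → ∃[ a ] f a ≡ z

  Irreducible : El → Set₁
  Irreducible x =
    ¬ (Σ[ Q ∈ FinPoset ] Σ[ R ∈ FinPoset ]
         (2 ≤ FinPoset.size Q) × (2 ≤ FinPoset.size R) ×
         (Σ[ f ∈ (Fin (FinPoset.size Q) × Fin (FinPoset.size R) → El) ]
            IsoOnto (ProdOrder Q R) x f))

  InI : El → Set₁
  InI x = (x ≢ 𝟘) × Irreducible x

  IsMaxBelow : Subset size → El → El → Set
  IsMaxBelow B x m =
    m ∈ B × m ≼ x × (∀ z → z ∈ B → z ≼ x → m ≼ z → z ≡ m)

  -- elements of ∏_{m ∈ max B_{≤x}} [𝟘, m], represented as functions g
  -- (values outside max B_{≤x} are irrelevant) with the product order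
  ProdDom : Subset size → El → Set
  ProdDom B x = Σ[ g ∈ (El → El) ] (∀ m → IsMaxBelow B x m → g m ≼ m)

  ProdDomOrder : (B : Subset size) (x : El) → Rel (ProdDom B x) 0ℓ
  ProdDomOrder B x (g , _) (g' , _) = ∀ m → IsMaxBelow B x m → g m ≼ g' m

  Family : (B : Subset size) (x : El) → ProdDom B x → El → Set
  Family B x (g , _) s = ∃[ m ] (IsMaxBelow B x m × s ≡ g m)

  BuildingAt : Subset size → El → Set
  BuildingAt B x =
    Σ[ J ∈ (ProdDom B x → El) ]
      ((∀ g → IsJoin (Family B x g) (J g)) × IsoOnto (ProdDomOrder B x) x J)

  IsBuildingSet : Subset size → Set
  IsBuildingSet B = (𝟘 ∉ B) × (∀ x → x ≢ 𝟘 → BuildingAt B x)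

  IsNested : Subset size → Subset size → Set
  IsNested B N =
    N ⊆ B ×
    (∀ (S : Subset size) → S ⊆ N → 2 ≤ ∣ S ∣ →
       (∀ a b → a ∈ S → b ∈ S → a ≼ b → a ≡ b) →
       ∃[ z ] (IsJoin (λ s → s ∈ S) z × z ∉ B))

record IsMSLEmbedding (L K : FinMSL) (f : Fin (FinMSL.size L) → Fin (FinMSL.size K)) : Set where
  field
    mono    : ∀ x y → FinMSL._≼_ L x y → FinMSL._≼_ K (f x) (f y)
    reflect : ∀ x y → FinMSL._≼_ K (f x) (f y) → FinMSL._≼_ L x y
    pres-∧  : ∀ x y → f (FinMSL._∧_ L x y) ≡ FinMSL._∧_ K (f x) (f y)

IsConsistent : (L K : FinMSL) (f : Fin (FinMSL.size L) → Fin (FinMSL.size K)) → Set₁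
IsConsistent L K f =
  ∀ x → x ≢ FinMSL.𝟘 L →
  ∀ k → InI K k → FinMSL._≼_ K k (f x) →
  ∃[ y ] (f y ≡ k × InI L y × FinMSL._≼_ L y x)

ContainsIL : (L K : FinMSL) (f : Fin (FinMSL.size L) → Fin (FinMSL.size K)) →
             Subset (FinMSL.size K) → Set₁
ContainsIL L K f B = ∀ x → InI L x → f x ∈ B

IsRestriction : (L K : FinMSL) (f : Fin (FinMSL.size L) → Fin (FinMSL.size K)) →
                Subset (FinMSL.size K) → Subset (FinMSL.size L) → Set
IsRestriction L K f B B' =
  ∀ x → (x ∈ B' → x ≢ FinMSL.𝟘 L × f x ∈ B) × (x ≢ FinMSL.𝟘 L × f x ∈ B → x ∈ B')

IsImage : (L K : FinMSL) (f : Fin (FinMSL.size L) → Fin (FinMSL.size K)) →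
          Subset (FinMSL.size L) → Subset (FinMSL.size K) → Set
IsImage L K f N M =
  ∀ k → (k ∈ M → ∃[ x ] (x ∈ N × f x ≡ k)) × (∃[ x ] (x ∈ N × f x ≡ k) → k ∈ M)

{-# OPTIONS --safe #-}
module Submission where

-- Irreducibility and building sets are first recast in first-order, decidable terms: [𝟘 , x]
-- splits as [𝟘 , a] × [𝟘 , b] exactly when y ↦ (y ∧ a , y ∧ b) inverts the join map, and B is
-- building at x exactly when the maximal elements of B below x decompose x in the same sense.
-- Splitting repeatedly, every x ≢ 𝟘 is decomposed by the maximal irreducibles below it. Hence
-- building sets contain I(P), x ≼ u can be tested on irreducibles, and B is building at x as
-- soon as it contains the irreducibles below x and max B≤x is pairwise disjoint.
--
-- Along the embedding f, consistency forces f 𝟘 = 𝟘 and makes every maximal element m of B below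
-- f l equal to f t for the least t with m ≼ f t. This shows that B ∩ L⁺ is building and that
-- nested sets of L stay nested in K. Conversely a building set B′ of L is the restriction of
-- B = {k ≢ 𝟘 : k has no bound in f(L), or its least bound in L lies in B′}, whose maximal elements
-- below any x are pairwise disjoint by induction on x.

open import Defs
open import Level using (0ℓ)
open import Function using (_∘_; id; const; case_of_)
open import Data.Nat using (ℕ; zero; suc; _≤_; _<_; z≤n; s≤s)
open import Data.Fin using (Fin; zero; suc; _≟_)
open import Data.Fin.Properties using (any?; all?; 0≢1+n; suc-injective)
open import Data.Fin.Induction using (po-wellFounded; po-noetherian)
open import Data.Fin.Subset using (Subset; inside; outside; _∈_; _∉_; _⊆_; ∣_∣; ⁅_⁆)
open import Data.Fin.Subset.Properties
  using (_∈?_; p⊂q⇒∣p∣<∣q∣; ∣⁅x⁆∣≡1; x∈⁅y⁆⇒x≡y; x≢y⇒x∉⁅y⁆)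
open import Data.Product using (Σ-syntax; ∃; ∃-syntax; _×_; _,_; proj₁; proj₂; swap)
open import Data.Sum using (_⊎_; inj₁; inj₂; [_,_])
open import Data.Vec using (tabulate; _∷_; here; there)
open import Data.Vec.Properties using (lookup∘tabulate; lookup⇒[]=; []=⇒lookup)
open import Data.Vec.Functional using (updateAt)
open import Data.Vec.Functional.Properties using (updateAt-updates; updateAt-minimal)
open import Induction.WellFounded using (module All)
open import Relation.Nullary using (¬_; Dec; yes; no; does; contradiction)
open import Relation.Nullary.Decidable
  using (map′; _×-dec_; _⊎-dec_; _→-dec_; ¬?; dec-true; decidable-stable)
open import Relation.Unary using (Pred; Decidable)
open import Relation.Binary.Core using (Rel)
open import Relation.Binary.Structures using (IsPartialOrder)
open import Relation.Binary.Lattice.Structures using (IsMeetSemilattice)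
open import Relation.Binary.Lattice.Bundles using (MeetSemilattice)
import Relation.Binary.Lattice.Properties.MeetSemilattice as MeetSemilatticeProperties
import Relation.Binary.Reasoning.PartialOrder as PosetReasoning
open import Relation.Binary.PropositionalEquality
  using (_≡_; _≢_; refl; sym; trans; cong; subst; subst₂; isEquivalence; module ≡-Reasoning)

subset : ∀ {n} {D : Pred (Fin n) 0ℓ} → Decidable D → Subset n
subset D? = tabulate (does ∘ D?)

∈-subset⁺ : ∀ {n} {D : Pred (Fin n) 0ℓ} (D? : Decidable D) {x} → D x → x ∈ subset D?
∈-subset⁺ D? {x} Dx = lookup⇒[]= x _ (trans (lookup∘tabulate _ x) (dec-true (D? x) Dx))

∈-subset⁻ : ∀ {n} {D : Pred (Fin n) 0ℓ} (D? : Decidable D) {x} → x ∈ subset D? → D x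
∈-subset⁻ D? {x} x∈ with D? x | trans (sym (lookup∘tabulate (does ∘ D?) x)) ([]=⇒lookup x∈)
... | yes Dx | _ = Dx
... | no _   | ()

distinct⇒2≤∣∣ : ∀ {n} {S : Subset n} {a b} → a ∈ S → b ∈ S → a ≢ b → 2 ≤ ∣ S ∣
distinct⇒2≤∣∣ {S = S} {a} a∈S b∈S a≢b =
  subst (_< ∣ S ∣) (∣⁅x⁆∣≡1 a) (p⊂q⇒∣p∣<∣q∣ (⁅a⁆⊆S , _ , b∈S , x≢y⇒x∉⁅y⁆ (a≢b ∘ sym)))
  where
  ⁅a⁆⊆S : ⁅ a ⁆ ⊆ S
  ⁅a⁆⊆S x∈⁅a⁆ = subst (_∈ S) (sym (x∈⁅y⁆⇒x≡y a x∈⁅a⁆)) a∈S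

1≤∣∣⇒nonempty : ∀ {n} (S : Subset n) → 1 ≤ ∣ S ∣ → ∃[ a ] a ∈ S
1≤∣∣⇒nonempty (inside ∷ S)  _ = zero , here
1≤∣∣⇒nonempty (outside ∷ S) 1≤∣S∣ =
  let a , a∈S = 1≤∣∣⇒nonempty S 1≤∣S∣ in suc a , there a∈S

2≤∣∣⇒distinct : ∀ {n} (S : Subset n) → 2 ≤ ∣ S ∣ → ∃[ a ] ∃[ b ] (a ∈ S × b ∈ S × a ≢ b)
2≤∣∣⇒distinct (inside ∷ S) (s≤s 1≤∣S∣) =
  let b , b∈S = 1≤∣∣⇒nonempty S 1≤∣S∣ in zero , suc b , here , there b∈S , 0≢1+n
2≤∣∣⇒distinct (outside ∷ S) 2≤∣S∣ =
  let a , b , a∈S , b∈S , a≢b = 2≤∣∣⇒distinct S 2≤∣S∣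
  in suc a , suc b , there a∈S , there b∈S , a≢b ∘ suc-injective

distinct⇒2≤ : ∀ {k} {i j : Fin k} → i ≢ j → 2 ≤ k
distinct⇒2≤ {suc zero}    {zero} {zero} i≢j = contradiction refl i≢j
distinct⇒2≤ {suc (suc k)} _ = s≤s (s≤s z≤n)

2≤⇒non-constant : ∀ {k} → 2 ≤ k → (c : Fin k) → ¬ (∀ i → i ≡ c)
2≤⇒non-constant (s≤s (s≤s _)) c constant =
  0≢1+n (trans (constant zero) (sym (constant (suc zero))))

record Enumeration {n : ℕ} (D : Pred (Fin n) 0ℓ) : Set where
  field
    length             : ℕ
    element            : Fin length → Fin n
    element∈           : ∀ i → D (element i)
    element-injective  : ∀ {i j} → element i ≡ element j → i ≡ j
    element-surjective : ∀ {x} → D x → ∃[ i ] element i ≡ x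

enumerate : ∀ {n} {D : Pred (Fin n) 0ℓ} → Decidable D → Enumeration D
enumerate {zero} D? = record
  { length = 0 ; element = λ () ; element∈ = λ ()
  ; element-injective = λ { {()} } ; element-surjective = λ { {()} } }
enumerate {suc n} {D} D? with enumerate (D? ∘ suc) | D? zero
... | E | no ¬D0 = record
  { length = length ; element = suc ∘ element ; element∈ = element∈
  ; element-injective = element-injective ∘ suc-injective ; element-surjective = surjective }
  where
  open Enumeration E
  surjective : ∀ {x} → D x → ∃[ i ] suc (element i) ≡ x
  surjective {zero}  D0 = contradiction D0 ¬D0
  surjective {suc x} Dx = let i , eq = element-surjective Dx in i , cong suc eq
... | E | yes D0 = record
  { length = suc length ; element = element′ ; element∈ = element′∈
  ; element-injective = injective ; element-surjective = surjective }
  where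
  open Enumeration E
  element′ : Fin (suc length) → Fin (suc n)
  element′ zero    = zero
  element′ (suc i) = suc (element i)
  element′∈ : ∀ i → D (element′ i)
  element′∈ zero    = D0
  element′∈ (suc i) = element∈ i
  injective : ∀ {i j} → element′ i ≡ element′ j → i ≡ j
  injective {zero}  {zero}  _  = refl
  injective {suc i} {suc j} eq = cong suc (element-injective (suc-injective eq))
  surjective : ∀ {x} → D x → ∃[ i ] element′ i ≡ x
  surjective {zero}  _  = zero , refl
  surjective {suc x} Dx = let i , eq = element-surjective Dx in suc i , cong suc eq

module Theory (P : FinMSL) where

  open FinMSL P public using (size; _≼?_; isMeetSemilattice; 𝟘; 𝟘-min)

  El : Set
  El = Fin size

  infix 4 _≼_
  _≼_ : Rel El 0ℓ
  _≼_ = FinMSL._≼_ P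

  infixr 7 _∧_
  _∧_ : El → El → El
  _∧_ = FinMSL._∧_ P

  open IsMeetSemilattice isMeetSemilattice public
    using (isPartialOrder; ∧-greatest)
    renaming ( refl to ≼-refl; trans to ≼-trans; antisym to ≼-antisym; reflexive to ≼-reflexive
             ; x∧y≤x to x∧y≼x; x∧y≤y to x∧y≼y )

  meetSemilattice : MeetSemilattice 0ℓ 0ℓ 0ℓ
  meetSemilattice = record { isMeetSemilattice = isMeetSemilattice }

  open MeetSemilatticeProperties meetSemilattice public
    using (∧-comm; ∧-assoc) renaming (∧-monotonic to ∧-mono; y≤x⇒x∧y≈y to y≼x⇒x∧y≡y)

  x≼y⇒x∧y≡x : ∀ {x y} → x ≼ y → x ∧ y ≡ x
  x≼y⇒x∧y≡x {x} {y} x≼y = trans (∧-comm x y) (y≼x⇒x∧y≡y x≼y)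

  ∧-monoˡ : ∀ {x y} z → x ≼ y → x ∧ z ≼ y ∧ z
  ∧-monoˡ z x≼y = ∧-mono x≼y ≼-refl

  ∧-absorbˡ : ∀ {y c} a → y ≼ c → y ∧ (c ∧ a) ≡ y ∧ a
  ∧-absorbˡ {y} {c} a y≼c = trans (sym (∧-assoc y c a)) (cong (_∧ a) (x≼y⇒x∧y≡x y≼c))

  ∧-factor : ∀ z {c m} → m ≼ c → z ∧ m ≡ (z ∧ c) ∧ m
  ∧-factor z {c} {m} m≼c = begin
    z ∧ m        ≡⟨ cong (z ∧_) (y≼x⇒x∧y≡y m≼c) ⟨
    z ∧ (c ∧ m)  ≡⟨ ∧-assoc z c m ⟨
    (z ∧ c) ∧ m  ∎
    where open ≡-Reasoning

  module ≼-Reasoning = PosetReasoning (MeetSemilattice.poset meetSemilattice)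

  ≼𝟘⇒≡𝟘 : ∀ {x} → x ≼ 𝟘 → x ≡ 𝟘
  ≼𝟘⇒≡𝟘 x≼𝟘 = ≼-antisym x≼𝟘 (𝟘-min _)

  _≺_ : Rel El 0ℓ
  x ≺ y = x ≼ y × x ≢ y

  ≺-rec : ∀ {ℓ} (Q : Pred El ℓ) → (∀ x → (∀ {y} → y ≺ x → Q y) → Q x) → ∀ x → Q x
  ≺-rec {ℓ} = All.wfRec (po-wellFounded isPartialOrder) ℓ

  ≻-rec : ∀ {ℓ} (Q : Pred El ℓ) → (∀ x → (∀ {y} → x ≺ y → Q y) → Q x) → ∀ x → Q x
  ≻-rec {ℓ} = All.wfRec (po-noetherian isPartialOrder) ℓ

  IsLeast : Pred El 0ℓ → El → Set
  IsLeast U t = U t × (∀ u → U u → t ≼ u)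

  IsMaximal : Pred El 0ℓ → El → Set
  IsMaximal A m = A m × (∀ z → A z → m ≼ z → z ≡ m)

  least-exists : {U : Pred El 0ℓ} → Decidable U → (∀ {a b} → U a → U b → U (a ∧ b)) →
                 ∀ {u} → U u → ∃ (IsLeast U)
  least-exists {U} U? ∧-closed {u} = ≺-rec (λ u → U u → ∃ (IsLeast U)) step u
    where
    step : ∀ u → (∀ {v} → v ≺ u → U v → ∃ (IsLeast U)) → U u → ∃ (IsLeast U)
    step u rec Uu with any? (λ v → U? v ×-dec ¬? (u ≼? v))
    ... | yes (v , Uv , u⋠v) =
      rec (x∧y≼x u v , λ u∧v≡u → u⋠v (subst (_≼ v) u∧v≡u (x∧y≼y u v))) (∧-closed Uu Uv)
    ... | no none = u , Uu , λ v Uv → decidable-stable (u ≼? v) (λ u⋠v → none (v , Uv , u⋠v))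

  maximal-above : {A : Pred El 0ℓ} → Decidable A → ∀ {a} → A a → ∃[ m ] (a ≼ m × IsMaximal A m)
  maximal-above {A} A? {a} = ≻-rec (λ a → A a → ∃[ m ] (a ≼ m × IsMaximal A m)) step a
    where
    step : ∀ a → (∀ {z} → a ≺ z → A z → ∃[ m ] (z ≼ m × IsMaximal A m)) →
           A a → ∃[ m ] (a ≼ m × IsMaximal A m)
    step a rec Aa with any? (λ z → A? z ×-dec (a ≼? z) ×-dec ¬? (a ≟ z))
    ... | yes (z , Az , a≼z , a≢z) =
      let m , z≼m , m-max = rec (a≼z , a≢z) Az in m , ≼-trans a≼z z≼m , m-max
    ... | no none = a , ≼-refl , Aa ,
      λ z Az a≼z → decidable-stable (z ≟ a) (λ z≢a → none (z , Az , a≼z , z≢a ∘ sym))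

  isMaximal? : {A : Pred El 0ℓ} → Decidable A → Decidable (IsMaximal A)
  isMaximal? A? m = A? m ×-dec all? (λ z → A? z →-dec (m ≼? z) →-dec (z ≟ m))

  UpperBound : Pred El 0ℓ → El → Set
  UpperBound S u = ∀ s → S s → s ≼ u

  upperBound? : {S : Pred El 0ℓ} → Decidable S → Decidable (UpperBound S)
  upperBound? S? u = all? (λ s → S? s →-dec (s ≼? u))

  isJoin? : {S : Pred El 0ℓ} → Decidable S → Decidable (IsJoin P S)
  isJoin? S? z = upperBound? S? z ×-dec all? (λ u → upperBound? S? u →-dec (z ≼? u))

  join-exists : {S : Pred El 0ℓ} → Decidable S → ∀ {u} → UpperBound S u → ∃ (IsJoin P S)
  join-exists S? = least-exists (upperBound? S?) (λ ub ub′ s s∈S → ∧-greatest (ub s s∈S) (ub′ s s∈S))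

  join-unique : ∀ {S : Pred El 0ℓ} {z z′} → IsJoin P S z → IsJoin P S z′ → z ≡ z′
  join-unique (ub , least) (ub′ , least′) = ≼-antisym (least _ ub′) (least′ _ ub)

  IsJoin₂ : El → El → El → Set
  IsJoin₂ p q = IsJoin P (λ s → s ≡ p ⊎ s ≡ q)

  join₂ : ∀ {p q z} → p ≼ z → q ≼ z → (∀ u → p ≼ u → q ≼ u → z ≼ u) → IsJoin₂ p q z
  join₂ p≼z q≼z least =
    (λ { _ (inj₁ refl) → p≼z ; _ (inj₂ refl) → q≼z }) ,
    (λ u ub → least u (ub _ (inj₁ refl)) (ub _ (inj₂ refl)))

  join₂-ubˡ : ∀ {p q z} → IsJoin₂ p q z → p ≼ z
  join₂-ubˡ (ub , _) = ub _ (inj₁ refl)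

  join₂-ubʳ : ∀ {p q z} → IsJoin₂ p q z → q ≼ z
  join₂-ubʳ (ub , _) = ub _ (inj₂ refl)

  join₂-least : ∀ {p q z u} → IsJoin₂ p q z → p ≼ u → q ≼ u → z ≼ u
  join₂-least (_ , least) p≼u q≼u = least _ (λ { _ (inj₁ refl) → p≼u ; _ (inj₂ refl) → q≼u })

  join₂-comm : ∀ {p q z} → IsJoin₂ p q z → IsJoin₂ q p z
  join₂-comm j = join₂ (join₂-ubʳ j) (join₂-ubˡ j) (λ u q≼u p≼u → join₂-least j p≼u q≼u)

  join₂? : ∀ p q → Decidable (IsJoin₂ p q)
  join₂? p q = isJoin? (λ s → (s ≟ p) ⊎-dec (s ≟ q))

  𝟘-join₂ : ∀ b → IsJoin₂ 𝟘 b b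
  𝟘-join₂ b = join₂ (𝟘-min b) ≼-refl (λ _ _ b≼u → b≼u)

  Image : Pred El 0ℓ → (El → El) → Pred El 0ℓ
  Image M g s = ∃[ m ] (M m × s ≡ g m)

  IsJoinᶠ : Pred El 0ℓ → (El → El) → El → Set
  IsJoinᶠ M g = IsJoin P (Image M g)

  joinᶠ : ∀ {M g z} → (∀ m → M m → g m ≼ z) → (∀ u → (∀ m → M m → g m ≼ u) → z ≼ u) →
          IsJoinᶠ M g z
  joinᶠ ub least =
    (λ { _ (m , m∈M , refl) → ub m m∈M }) ,
    (λ u ub′ → least u (λ m m∈M → ub′ _ (m , m∈M , refl)))

  joinᶠ-ub : ∀ {M g z m} → IsJoinᶠ M g z → M m → g m ≼ z
  joinᶠ-ub (ub , _) m∈M = ub _ (_ , m∈M , refl)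

  joinᶠ-least : ∀ {M g z u} → IsJoinᶠ M g z → (∀ m → M m → g m ≼ u) → z ≼ u
  joinᶠ-least (_ , least) ub = least _ (λ { _ (m , m∈M , refl) → ub m m∈M })

  joinᶠ-exists : ∀ {M} → Decidable M → ∀ g {u} → (∀ m → M m → g m ≼ u) → ∃ (IsJoinᶠ M g)
  joinᶠ-exists M? g ub =
    join-exists (λ s → any? (λ m → M? m ×-dec (s ≟ g m))) (λ { _ (m , m∈M , refl) → ub m m∈M })

  joinᶠ-cong : ∀ {M M′ g z} → (∀ {m} → M m → M′ m) → (∀ {m} → M′ m → M m) →
               IsJoinᶠ M g z → IsJoinᶠ M′ g z
  joinᶠ-cong M⊆M′ M′⊆M j =
    joinᶠ (λ m m∈M′ → joinᶠ-ub j (M′⊆M m∈M′)) (λ u ub → joinᶠ-least j (λ m m∈M → ub m (M⊆M′ m∈M)))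

  joinᶠ-least-around : ∀ {M g z u} d → IsJoinᶠ M g z →
                       g d ≼ u → (∀ m → M m → m ≢ d → g m ≼ u) → z ≼ u
  joinᶠ-least-around {M} {g} {u = u} d z-join gd≼u others = joinᶠ-least z-join bound
    where
    bound : ∀ m → M m → g m ≼ u
    bound m m∈M with m ≟ d
    ... | yes refl = gd≼u
    ... | no m≢d = others m m∈M m≢d

  infixl 9 _[_≔_]
  _[_≔_] : (El → El) → El → El → El → El
  g [ m ≔ v ] = updateAt g m (const v)

  update-cases : ∀ (Q : El → Set) g m v w →
                 (w ≡ m → Q v) → (w ≢ m → Q (g w)) → Q ((g [ m ≔ v ]) w)
  update-cases Q g m v w at off with w ≟ m
  ... | yes refl = subst Q (sym (updateAt-updates m g)) (at refl)
  ... | no w≢m   = subst Q (sym (updateAt-minimal w m g w≢m)) (off w≢m)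

  update-at : ∀ g m v → (g [ m ≔ v ]) m ≡ v
  update-at g m v = updateAt-updates m g

  -- Splits and irreducibility

  -- [𝟘 , x] ≅ [𝟘 , a] × [𝟘 , b] via (y₁ , y₂) ↦ y₁ ∨ y₂, with inverse y ↦ (y ∧ a , y ∧ b).
  record Split (x a b : El) : Set where
    field
      a≢𝟘           : a ≢ 𝟘
      b≢𝟘           : b ≢ 𝟘
      a≼x           : a ≼ x
      b≼x           : b ≼ x
      join-of-meets : ∀ y → y ≼ x → IsJoin₂ (y ∧ a) (y ∧ b) y
      meets-of-join : ∀ y₁ y₂ z → y₁ ≼ a → y₂ ≼ b → IsJoin₂ y₁ y₂ z → z ∧ a ≡ y₁ × z ∧ b ≡ y₂

  split? : ∀ x a b → Dec (Split x a b)
  split? x a b = map′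
    (λ (p₁ , p₂ , p₃ , p₄ , p₅ , p₆) → record
      { a≢𝟘 = p₁ ; b≢𝟘 = p₂ ; a≼x = p₃ ; b≼x = p₄ ; join-of-meets = p₅ ; meets-of-join = p₆ })
    (λ s → a≢𝟘 s , b≢𝟘 s , a≼x s , b≼x s , join-of-meets s , meets-of-join s)
    (¬? (a ≟ 𝟘) ×-dec ¬? (b ≟ 𝟘) ×-dec a ≼? x ×-dec b ≼? x ×-dec
     all? (λ y → y ≼? x →-dec join₂? (y ∧ a) (y ∧ b) y) ×-dec
     all? (λ y₁ → all? (λ y₂ → all? (λ z → y₁ ≼? a →-dec y₂ ≼? b →-dec
       join₂? y₁ y₂ z →-dec (z ∧ a ≟ y₁) ×-dec (z ∧ b ≟ y₂)))))
    where open Split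

  split-comm : ∀ {x a b} → Split x a b → Split x b a
  split-comm s = record
    { a≢𝟘 = b≢𝟘 ; b≢𝟘 = a≢𝟘 ; a≼x = b≼x ; b≼x = a≼x
    ; join-of-meets = λ y y≼x → join₂-comm (join-of-meets y y≼x)
    ; meets-of-join = λ y₁ y₂ z y₁≼b y₂≼a j →
        let z∧a≡y₂ , z∧b≡y₁ = meets-of-join y₂ y₁ z y₂≼a y₁≼b (join₂-comm j) in z∧b≡y₁ , z∧a≡y₂ }
    where open Split s

  split-disjoint : ∀ {x a b} → Split x a b → a ∧ b ≡ 𝟘
  split-disjoint {a = a} {b} s =
    trans (∧-comm a b) (proj₁ (Split.meets-of-join s 𝟘 b b (𝟘-min a) ≼-refl (𝟘-join₂ b)))

  split-proper : ∀ {x a b} → Split x a b → a ≢ x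
  split-proper {a = a} {b} s refl = Split.b≢𝟘 s (begin
    b      ≡⟨ y≼x⇒x∧y≡y (Split.b≼x s) ⟨
    a ∧ b  ≡⟨ split-disjoint s ⟩
    𝟘      ∎)
    where open ≡-Reasoning

  HasSplit : El → Set
  HasSplit x = ∃[ a ] ∃[ b ] Split x a b

  hasSplit? : Decidable HasSplit
  hasSplit? x = any? (λ a → any? (λ b → split? x a b))

  Indecomposable : El → Set
  Indecomposable x = x ≢ 𝟘 × ¬ HasSplit x

  indecomposable? : Decidable Indecomposable
  indecomposable? x = ¬? (x ≟ 𝟘) ×-dec ¬? (hasSplit? x)

  module Interval (a : El) = Enumeration (enumerate (_≼? a))

  interval : El → FinPoset
  interval a = record
    { size = length
    ; _≼_ = λ i j → element i ≼ element j
    ; isPartialOrder = record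
      { isPreorder = record
        { isEquivalence = isEquivalence ; reflexive = λ { refl → ≼-refl } ; trans = ≼-trans }
      ; antisym = λ i≼j j≼i → element-injective (≼-antisym i≼j j≼i) } }
    where open Interval a

  2≤∣interval∣ : ∀ {a} → a ≢ 𝟘 → 2 ≤ FinPoset.size (interval a)
  2≤∣interval∣ {a} a≢𝟘 with element-surjective (𝟘-min a) | element-surjective (≼-refl {a})
    where open Interval a
  ... | i , refl | j , eq = distinct⇒2≤ {i = i} {j} (λ { refl → a≢𝟘 (sym eq) })

  split⇒reducible : ∀ {x a b} → Split x a b → ¬ Irreducible P x
  split⇒reducible {x} {a} {b} s irreducible =
    irreducible (interval a , interval b , 2≤∣interval∣ a≢𝟘 , 2≤∣interval∣ b≢𝟘 , φ , iso)
    where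
    open Split s
    module A = Interval a
    module B = Interval b

    join-exists′ : ∀ i j → ∃ (IsJoin₂ (A.element i) (B.element j))
    join-exists′ i j = join-exists (λ s → (s ≟ A.element i) ⊎-dec (s ≟ B.element j))
      (λ { _ (inj₁ refl) → ≼-trans (A.element∈ i) a≼x ; _ (inj₂ refl) → ≼-trans (B.element∈ j) b≼x })

    φ : Fin A.length × Fin B.length → El
    φ (i , j) = proj₁ (join-exists′ i j)

    φ-join : ∀ i j → IsJoin₂ (A.element i) (B.element j) (φ (i , j))
    φ-join i j = proj₂ (join-exists′ i j)

    φ-meets : ∀ i j → φ (i , j) ∧ a ≡ A.element i × φ (i , j) ∧ b ≡ B.element j
    φ-meets i j = meets-of-join _ _ _ (A.element∈ i) (B.element∈ j) (φ-join i j)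

    iso : IsoOnto P (ProdOrder (interval a) (interval b)) x φ
    iso = record
      { lands = λ (i , j) →
          join₂-least (φ-join i j) (≼-trans (A.element∈ i) a≼x) (≼-trans (B.element∈ j) b≼x)
      ; mono = λ (i , j) (i′ , j′) (i≼i′ , j≼j′) → join₂-least (φ-join i j)
          (≼-trans i≼i′ (join₂-ubˡ (φ-join i′ j′))) (≼-trans j≼j′ (join₂-ubʳ (φ-join i′ j′)))
      ; reflect = λ (i , j) (i′ , j′) φ≼φ′ →
          subst₂ _≼_ (proj₁ (φ-meets i j)) (proj₁ (φ-meets i′ j′)) (∧-monoˡ a φ≼φ′) ,
          subst₂ _≼_ (proj₂ (φ-meets i j)) (proj₂ (φ-meets i′ j′)) (∧-monoˡ b φ≼φ′)
      ; onto = onto }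
      where
      onto : ∀ y → y ≼ x → ∃[ ij ] φ ij ≡ y
      onto y y≼x with A.element-surjective (x∧y≼y y a) | B.element-surjective (x∧y≼y y b)
      ... | i , eᵢ | j , eⱼ = (i , j) , join-unique (φ-join i j)
        (subst₂ (λ p q → IsJoin₂ p q y) (sym eᵢ) (sym eⱼ) (join-of-meets y y≼x))

  module ProductSplit {x} (Q R : FinPoset) (φ : Fin (FinPoset.size Q) × Fin (FinPoset.size R) → El)
                      (iso : IsoOnto P (ProdOrder Q R) x φ) where
    open IsoOnto iso
    private
      module Q = FinPoset Q
      module R = FinPoset R
      module ≼Q = IsPartialOrder Q.isPartialOrder
      module ≼R = IsPartialOrder R.isPartialOrder

    q₀ q₁ : Fin Q.size
    q₀ = proj₁ (proj₁ (onto 𝟘 (𝟘-min x)))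
    q₁ = proj₁ (proj₁ (onto x ≼-refl))

    r₀ r₁ : Fin R.size
    r₀ = proj₂ (proj₁ (onto 𝟘 (𝟘-min x)))
    r₁ = proj₂ (proj₁ (onto x ≼-refl))

    φ-bottom : φ (q₀ , r₀) ≡ 𝟘
    φ-bottom = proj₂ (onto 𝟘 (𝟘-min x))

    φ-top : φ (q₁ , r₁) ≡ x
    φ-top = proj₂ (onto x ≼-refl)

    above-bottom : ∀ q r → q₀ Q.≼ q × r₀ R.≼ r
    above-bottom q r = reflect _ _ (subst (_≼ φ (q , r)) (sym φ-bottom) (𝟘-min _))

    below-top : ∀ q r → q Q.≼ q₁ × r R.≼ r₁
    below-top q r = reflect _ _ (subst (φ (q , r) ≼_) (sym φ-top) (lands _))

    a : El
    a = φ (q₁ , r₀)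

    a≢𝟘 : 2 ≤ Q.size → a ≢ 𝟘
    a≢𝟘 2≤∣Q∣ a≡𝟘 = 2≤⇒non-constant 2≤∣Q∣ q₀ (λ q →
      ≼Q.antisym (≼Q.trans (proj₁ (below-top q r₀)) q₁≼q₀) (proj₁ (above-bottom q r₀)))
      where
      q₁≼q₀ : q₁ Q.≼ q₀
      q₁≼q₀ = proj₁ (reflect _ _ (subst₂ _≼_ (sym a≡𝟘) (sym φ-bottom) ≼-refl))

    φ∧a : ∀ q r → φ (q , r) ∧ a ≡ φ (q , r₀)
    φ∧a q r with onto (φ (q , r) ∧ a) (≼-trans (x∧y≼y _ _) (lands _))
    ... | (q′ , r′) , φ′≡ = ≼-antisym
      (subst (_≼ φ (q , r₀)) φ′≡
        (mono _ _ (proj₁ (reflect _ _ (subst (_≼ φ (q , r)) (sym φ′≡) (x∧y≼x _ _))) ,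
                   proj₂ (reflect _ _ (subst (_≼ a) (sym φ′≡) (x∧y≼y _ _))))))
      (∧-greatest (mono _ _ (≼Q.refl , proj₂ (above-bottom q r)))
                  (mono _ _ (proj₁ (below-top q r₀) , ≼R.refl)))

    φ-join : ∀ q r → IsJoin₂ (φ (q , r₀)) (φ (q₀ , r)) (φ (q , r))
    φ-join q r = join₂ (mono _ _ (≼Q.refl , proj₂ (above-bottom q r)))
                       (mono _ _ (proj₁ (above-bottom q r) , ≼R.refl)) least
      where
      least : ∀ u → φ (q , r₀) ≼ u → φ (q₀ , r) ≼ u → φ (q , r) ≼ u
      least u ≼u ≼u′ with onto (u ∧ x) (x∧y≼y _ _)
      ... | (q′ , r′) , φ′≡ =
        ≼-trans (subst (φ (q , r) ≼_) φ′≡ (mono _ _ (q≼q′ , r≼r′))) (x∧y≼x _ _)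
        where
        q≼q′ : q Q.≼ q′
        q≼q′ = proj₁ (reflect _ _ (subst (φ (q , r₀) ≼_) (sym φ′≡) (∧-greatest ≼u (lands _))))
        r≼r′ : r R.≼ r′
        r≼r′ = proj₂ (reflect _ _ (subst (φ (q₀ , r) ≼_) (sym φ′≡) (∧-greatest ≼u′ (lands _))))

  swap-iso : ∀ {x} {Q R : FinPoset} {φ} →
             IsoOnto P (ProdOrder Q R) x φ → IsoOnto P (ProdOrder R Q) x (φ ∘ swap)
  swap-iso iso = record
    { lands = lands ∘ swap
    ; mono = λ u v (r≼ , q≼) → mono (swap u) (swap v) (q≼ , r≼)
    ; reflect = λ u v φu≼φv → swap (reflect (swap u) (swap v) φu≼φv)
    ; onto = λ z z≼x → let qr , φqr≡z = onto z z≼x in swap qr , φqr≡z }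
    where open IsoOnto iso

  product⇒split : ∀ {x} (Q R : FinPoset) → 2 ≤ FinPoset.size Q → 2 ≤ FinPoset.size R →
                  ∀ φ → IsoOnto P (ProdOrder Q R) x φ → HasSplit x
  product⇒split {x} Q R 2≤∣Q∣ 2≤∣R∣ φ iso = a , b , record
    { a≢𝟘 = a≢𝟘 2≤∣Q∣ ; b≢𝟘 = Swapped.a≢𝟘 2≤∣R∣ ; a≼x = lands _ ; b≼x = lands _
    ; join-of-meets = join-of-meets ; meets-of-join = meets-of-join }
    where
    open IsoOnto iso
    open ProductSplit Q R φ iso
    module Swapped = ProductSplit R Q (φ ∘ swap) (swap-iso {Q = Q} {R} iso)
    module ≼Q = IsPartialOrder (FinPoset.isPartialOrder Q)
    module ≼R = IsPartialOrder (FinPoset.isPartialOrder R)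

    b : El
    b = Swapped.a

    join-of-meets : ∀ y → y ≼ x → IsJoin₂ (y ∧ a) (y ∧ b) y
    join-of-meets y y≼x with onto y y≼x
    ... | (q , r) , refl = subst₂ (λ p p′ → IsJoin₂ p p′ (φ (q , r)))
                             (sym (φ∧a q r)) (sym (Swapped.φ∧a r q)) (φ-join q r)

    meets-of-join : ∀ y₁ y₂ z → y₁ ≼ a → y₂ ≼ b → IsJoin₂ y₁ y₂ z → z ∧ a ≡ y₁ × z ∧ b ≡ y₂
    meets-of-join y₁ y₂ z y₁≼a y₂≼b z-join
      with onto y₁ (≼-trans y₁≼a (lands _)) | onto y₂ (≼-trans y₂≼b (lands _))
    ... | (q , r) , refl | (q′ , r′) , refl
      with ≼R.antisym (proj₂ (reflect _ _ y₁≼a)) (proj₂ (above-bottom q r))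
         | ≼Q.antisym (proj₁ (reflect _ _ y₂≼b)) (proj₁ (above-bottom q′ r′))
    ... | refl | refl with join-unique z-join (φ-join q r′)
    ... | refl = φ∧a q r′ , Swapped.φ∧a r′ q

  InI⇒indecomposable : ∀ {x} → InI P x → Indecomposable x
  InI⇒indecomposable (x≢𝟘 , irreducible) = x≢𝟘 , λ (_ , _ , s) → split⇒reducible s irreducible

  indecomposable⇒InI : ∀ {x} → Indecomposable x → InI P x
  indecomposable⇒InI (x≢𝟘 , no-split) =
    x≢𝟘 , λ (Q , R , 2≤∣Q∣ , 2≤∣R∣ , φ , iso) → no-split (product⇒split Q R 2≤∣Q∣ 2≤∣R∣ φ iso)

  -- Decompositions

  JoinOfMeets : El → Pred El 0ℓ → Set
  JoinOfMeets x M = ∀ y → y ≼ x → IsJoinᶠ M (y ∧_) y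

  MeetsOfJoin : Pred El 0ℓ → Set
  MeetsOfJoin M = ∀ g → (∀ m → M m → g m ≼ m) → ∀ z → IsJoinᶠ M g z → ∀ {m} → M m → z ∧ m ≡ g m

  -- The join map ∏_{m ∈ M} [𝟘 , m] → [𝟘 , x] is an isomorphism with inverse y ↦ (y ∧ m)_m.
  record Decomposition (x : El) (M : Pred El 0ℓ) : Set where
    field
      component≼    : ∀ {m} → M m → m ≼ x
      join-of-meets : JoinOfMeets x M
      meets-of-join : MeetsOfJoin M

  decomposition-cong : ∀ {x M M′} → (∀ {m} → M m → M′ m) → (∀ {m} → M′ m → M m) →
                       Decomposition x M → Decomposition x M′
  decomposition-cong M⊆M′ M′⊆M D = record
    { component≼ = component≼ ∘ M′⊆M
    ; join-of-meets = λ y y≼x → joinᶠ-cong M⊆M′ M′⊆M (join-of-meets y y≼x)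
    ; meets-of-join = λ g g≼ z z-join m∈M′ →
        meets-of-join g (λ m m∈M → g≼ m (M⊆M′ m∈M)) z (joinᶠ-cong M′⊆M M⊆M′ z-join) (M′⊆M m∈M′) }
    where open Decomposition D

  singleton-decomposition : ∀ {x M} → (∀ {m} → M m → m ≡ x) → M x → Decomposition x M
  singleton-decomposition {x} {M} ≡x x∈M = record
    { component≼ = ≼-reflexive ∘ ≡x
    ; join-of-meets = λ y y≼x →
        joinᶠ (λ m _ → x∧y≼x y m) (λ u ub → subst (_≼ u) (x≼y⇒x∧y≡x y≼x) (ub x x∈M))
    ; meets-of-join = meets-of-join }
    where
    meets-of-join : MeetsOfJoin M
    meets-of-join g g≼ z z-join m∈M with ≡x m∈M
    ... | refl = begin
      z ∧ x    ≡⟨ cong (_∧ x) z≡gx ⟩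
      g x ∧ x  ≡⟨ x≼y⇒x∧y≡x (g≼ x m∈M) ⟩
      g x      ∎
      where
      open ≡-Reasoning
      z≡gx : z ≡ g x
      z≡gx = ≼-antisym (joinᶠ-least z-join (λ m m∈M → ≼-reflexive (cong g (≡x m∈M))))
                       (joinᶠ-ub z-join m∈M)

  joinᶠ-indicator : ∀ {M m} v → M m → IsJoinᶠ M (const 𝟘 [ m ≔ v ]) v
  joinᶠ-indicator {m = m} v m∈M =
    joinᶠ (λ w _ → update-cases (_≼ v) (const 𝟘) m v w (λ _ → ≼-refl) (λ _ → 𝟘-min v))
          (λ u ub → subst (_≼ u) (update-at (const 𝟘) m v) (ub m m∈M))

  decomposition-disjoint : ∀ {x M m m′} → Decomposition x M → M m → M m′ → m ≢ m′ → m ∧ m′ ≡ 𝟘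
  decomposition-disjoint {m = m} {m′} D m∈M m′∈M m≢m′ = begin
    m ∧ m′                  ≡⟨ Decomposition.meets-of-join D g g≼ m (joinᶠ-indicator m m∈M) m′∈M ⟩
    (const 𝟘 [ m ≔ m ]) m′  ≡⟨ updateAt-minimal m′ m (const 𝟘) (m≢m′ ∘ sym) ⟩
    𝟘                       ∎
    where
    open ≡-Reasoning
    g = const 𝟘 [ m ≔ m ]
    g≼ : ∀ w → _ → g w ≼ w
    g≼ w _ = update-cases (_≼ w) (const 𝟘) m m w (≼-reflexive ∘ sym) (λ _ → 𝟘-min w)

  split-restrict : ∀ {x a b c} → Split x a b → c ≼ x → c ∧ a ≢ 𝟘 → c ∧ b ≢ 𝟘 →
                   Split c (c ∧ a) (c ∧ b)
  split-restrict {x} {a} {b} {c} s c≼x c∧a≢𝟘 c∧b≢𝟘 = record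
    { a≢𝟘 = c∧a≢𝟘 ; b≢𝟘 = c∧b≢𝟘 ; a≼x = x∧y≼x c a ; b≼x = x∧y≼x c b
    ; join-of-meets = λ y y≼c → subst₂ (λ p q → IsJoin₂ p q y)
        (sym (∧-absorbˡ a y≼c)) (sym (∧-absorbˡ b y≼c)) (join-of-meets y (≼-trans y≼c c≼x))
    ; meets-of-join = meets-of-join′ }
    where
    open Split s
    meets-of-join′ : ∀ y₁ y₂ z → y₁ ≼ c ∧ a → y₂ ≼ c ∧ b → IsJoin₂ y₁ y₂ z →
                     z ∧ (c ∧ a) ≡ y₁ × z ∧ (c ∧ b) ≡ y₂
    meets-of-join′ y₁ y₂ z y₁≼ y₂≼ z-join =
      trans (∧-absorbˡ a z≼c) (proj₁ meets) , trans (∧-absorbˡ b z≼c) (proj₂ meets)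
      where
      z≼c : z ≼ c
      z≼c = join₂-least z-join (≼-trans y₁≼ (x∧y≼x c a)) (≼-trans y₂≼ (x∧y≼x c b))
      meets : z ∧ a ≡ y₁ × z ∧ b ≡ y₂
      meets = meets-of-join y₁ y₂ z (≼-trans y₁≼ (x∧y≼y c a)) (≼-trans y₂≼ (x∧y≼y c b)) z-join

  split-≼ʳ : ∀ {x a b c} → Split x a b → c ≼ x → c ∧ a ≡ 𝟘 → c ≼ b
  split-≼ʳ {a = a} {b} {c} s c≼x c∧a≡𝟘 = begin
    c      ≤⟨ join₂-least (Split.join-of-meets s c c≼x) (subst (_≼ c ∧ b) (sym c∧a≡𝟘) (𝟘-min _)) ≼-refl ⟩
    c ∧ b  ≤⟨ x∧y≼y c b ⟩
    b      ∎
    where open ≼-Reasoning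

  split-side : ∀ {x a b c} → Split x a b → Indecomposable c → c ≼ x → c ≼ a ⊎ c ≼ b
  split-side {a = a} {b} {c} s (_ , no-split) c≼x with c ∧ a ≟ 𝟘 | c ∧ b ≟ 𝟘
  ... | yes c∧a≡𝟘 | _         = inj₂ (split-≼ʳ s c≼x c∧a≡𝟘)
  ... | no _      | yes c∧b≡𝟘 = inj₁ (split-≼ʳ (split-comm s) c≼x c∧b≡𝟘)
  ... | no c∧a≢𝟘  | no c∧b≢𝟘  = contradiction (c ∧ a , c ∧ b , split-restrict s c≼x c∧a≢𝟘 c∧b≢𝟘) no-split

  split-decomposition : ∀ {x a b Ma Mb} → Split x a b → Decidable Ma → Decidable Mb →
                        Decomposition a Ma → Decomposition b Mb →
                        Decomposition x (λ m → Ma m ⊎ Mb m)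
  split-decomposition {x} {a} {b} {Ma} {Mb} s Ma? Mb? DA DB = record
    { component≼ = λ { (inj₁ m∈Ma) → ≼-trans (A.component≼ m∈Ma) a≼x
                     ; (inj₂ m∈Mb) → ≼-trans (B.component≼ m∈Mb) b≼x }
    ; join-of-meets = join-of-meets′ ; meets-of-join = meets-of-join′ }
    where
    open Split s
    module A = Decomposition DA
    module B = Decomposition DB
    open ≡-Reasoning
    M : Pred El 0ℓ
    M m = Ma m ⊎ Mb m

    join-of-meets′ : JoinOfMeets x M
    join-of-meets′ y y≼x = joinᶠ (λ m _ → x∧y≼x y m) λ u ub → join₂-least (join-of-meets y y≼x)
      (joinᶠ-least (A.join-of-meets (y ∧ a) (x∧y≼y y a))
        (λ m m∈Ma → ≼-trans (∧-monoˡ m (x∧y≼x y a)) (ub m (inj₁ m∈Ma))))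
      (joinᶠ-least (B.join-of-meets (y ∧ b) (x∧y≼y y b))
        (λ m m∈Mb → ≼-trans (∧-monoˡ m (x∧y≼x y b)) (ub m (inj₂ m∈Mb))))

    module Coordinates g (g≼ : ∀ m → M m → g m ≼ m) z (z-join : IsJoinᶠ M g z) where
      za-exists : ∃ (IsJoinᶠ Ma g)
      za-exists = joinᶠ-exists Ma? g (λ m m∈Ma → ≼-trans (g≼ m (inj₁ m∈Ma)) (A.component≼ m∈Ma))

      zb-exists : ∃ (IsJoinᶠ Mb g)
      zb-exists = joinᶠ-exists Mb? g (λ m m∈Mb → ≼-trans (g≼ m (inj₂ m∈Mb)) (B.component≼ m∈Mb))

      za zb : El
      za = proj₁ za-exists
      zb = proj₁ zb-exists

      za-join : IsJoinᶠ Ma g za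
      za-join = proj₂ za-exists

      zb-join : IsJoinᶠ Mb g zb
      zb-join = proj₂ zb-exists

      z-join₂ : IsJoin₂ za zb z
      z-join₂ = join₂ (joinᶠ-least za-join (λ m m∈Ma → joinᶠ-ub z-join (inj₁ m∈Ma)))
                      (joinᶠ-least zb-join (λ m m∈Mb → joinᶠ-ub z-join (inj₂ m∈Mb)))
                      (λ u za≼u zb≼u → joinᶠ-least z-join λ
                        { m (inj₁ m∈Ma) → ≼-trans (joinᶠ-ub za-join m∈Ma) za≼u
                        ; m (inj₂ m∈Mb) → ≼-trans (joinᶠ-ub zb-join m∈Mb) zb≼u })

      za≼a : za ≼ a
      za≼a = joinᶠ-least za-join (λ m m∈Ma → ≼-trans (g≼ m (inj₁ m∈Ma)) (A.component≼ m∈Ma))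

      zb≼b : zb ≼ b
      zb≼b = joinᶠ-least zb-join (λ m m∈Mb → ≼-trans (g≼ m (inj₂ m∈Mb)) (B.component≼ m∈Mb))

      z∧a≡za : z ∧ a ≡ za
      z∧a≡za = proj₁ (meets-of-join za zb z za≼a zb≼b z-join₂)

      z∧b≡zb : z ∧ b ≡ zb
      z∧b≡zb = proj₂ (meets-of-join za zb z za≼a zb≼b z-join₂)

    meets-of-join′ : MeetsOfJoin M
    meets-of-join′ g g≼ z z-join {m} (inj₁ m∈Ma) = begin
      z ∧ m        ≡⟨ ∧-factor z (A.component≼ m∈Ma) ⟩
      (z ∧ a) ∧ m  ≡⟨ cong (_∧ m) z∧a≡za ⟩
      za ∧ m       ≡⟨ A.meets-of-join g (λ m → g≼ m ∘ inj₁) za za-join m∈Ma ⟩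
      g m          ∎
      where open Coordinates g g≼ z z-join
    meets-of-join′ g g≼ z z-join {m} (inj₂ m∈Mb) = begin
      z ∧ m        ≡⟨ ∧-factor z (B.component≼ m∈Mb) ⟩
      (z ∧ b) ∧ m  ≡⟨ cong (_∧ m) z∧b≡zb ⟩
      zb ∧ m       ≡⟨ B.meets-of-join g (λ m → g≼ m ∘ inj₂) zb zb-join m∈Mb ⟩
      g m          ∎
      where open Coordinates g g≼ z z-join

  Component : El → Pred El 0ℓ
  Component x = IsMaximal (λ c → Indecomposable c × c ≼ x)

  component? : ∀ x → Decidable (Component x)
  component? x = isMaximal? (λ c → indecomposable? c ×-dec c ≼? x)

  component-of-split : ∀ {x a b m} → Split x a b → Component a m → Component x m
  component-of-split {m = m} s ((m-ind , m≼a) , maximal) = (m-ind , ≼-trans m≼a a≼x) , maximal′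
    where
    open Split s
    maximal′ : ∀ z → Indecomposable z × z ≼ _ → m ≼ z → z ≡ m
    maximal′ z (z-ind , z≼x) m≼z with split-side s z-ind z≼x
    ... | inj₁ z≼a = maximal z (z-ind , z≼a) m≼z
    ... | inj₂ z≼b = contradiction
      (≼𝟘⇒≡𝟘 (subst (m ≼_) (split-disjoint s) (∧-greatest m≼a (≼-trans m≼z z≼b)))) (proj₁ m-ind)

  component-split : ∀ {x a b m} → Split x a b → Component x m → Component a m ⊎ Component b m
  component-split s ((m-ind , m≼x) , maximal) with split-side s m-ind m≼x
  ... | inj₁ m≼a = inj₁ ((m-ind , m≼a) , λ z (z-ind , z≼a) → maximal z (z-ind , ≼-trans z≼a a≼x))
    where open Split s
  ... | inj₂ m≼b = inj₂ ((m-ind , m≼b) , λ z (z-ind , z≼b) → maximal z (z-ind , ≼-trans z≼b b≼x))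
    where open Split s

  components-decomposition : ∀ {x} → x ≢ 𝟘 → Decomposition x (Component x)
  components-decomposition {x} = ≺-rec (λ x → x ≢ 𝟘 → Decomposition x (Component x)) step x
    where
    step : ∀ x → (∀ {y} → y ≺ x → y ≢ 𝟘 → Decomposition y (Component y)) →
           x ≢ 𝟘 → Decomposition x (Component x)
    step x rec x≢𝟘 with hasSplit? x
    ... | no no-split = singleton-decomposition (λ ((_ , m≼x) , maximal) → sym (maximal x x-below m≼x))
                                                (x-below , λ _ (_ , z≼x) x≼z → ≼-antisym z≼x x≼z)
      where
      x-below : Indecomposable x × x ≼ x
      x-below = (x≢𝟘 , no-split) , ≼-refl
    ... | yes (a , b , s) =
      decomposition-cong [ component-of-split s , component-of-split (split-comm s) ] (component-split s)
        (split-decomposition s (component? a) (component? b)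
          (rec (a≼x , split-proper s) a≢𝟘) (rec (b≼x , split-proper (split-comm s)) b≢𝟘))
      where open Split s

  component-above : ∀ {x c} → Indecomposable c → c ≼ x → ∃[ d ] (Component x d × c ≼ d)
  component-above {x} c-ind c≼x =
    let d , c≼d , d∈C = maximal-above (λ c → indecomposable? c ×-dec c ≼? x) (c-ind , c≼x)
    in d , d∈C , c≼d

  ≼-via-indecomposables : ∀ {x u} → (∀ c → Indecomposable c → c ≼ x → c ≼ u) → x ≼ u
  ≼-via-indecomposables {x} {u} below-u with x ≟ 𝟘
  ... | yes refl = 𝟘-min u
  ... | no x≢𝟘 = joinᶠ-least (Decomposition.join-of-meets (components-decomposition x≢𝟘) x ≼-refl)
                   (λ c ((c-ind , c≼x) , _) → ≼-trans (x∧y≼y x c) (below-u c c-ind c≼x))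

  -- rest is the join of M ∖ {d}, presented as the join of id [ d ≔ 𝟘 ] over M so that
  -- meets-of-join applies to it.
  module Rest {x M} (D : Decomposition x M) (M? : Decidable M) {d} (d∈M : M d) where
    open Decomposition D

    private
      others : El → El
      others = id [ d ≔ 𝟘 ]

      others≼ : ∀ m → M m → others m ≼ m
      others≼ m _ = update-cases (_≼ m) id d 𝟘 m (λ _ → 𝟘-min m) (λ _ → ≼-refl)

      rest-exists : ∃ (IsJoinᶠ M others)
      rest-exists = joinᶠ-exists M? others (λ m m∈M → ≼-trans (others≼ m m∈M) (component≼ m∈M))

    rest : El
    rest = proj₁ rest-exists

    rest-join : IsJoinᶠ M others rest
    rest-join = proj₂ rest-exists

    rest≼x : rest ≼ x
    rest≼x = joinᶠ-least rest-join (λ m m∈M → ≼-trans (others≼ m m∈M) (component≼ m∈M))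

    ≼rest : ∀ {m} → M m → m ≢ d → m ≼ rest
    ≼rest {m} m∈M m≢d = subst (_≼ rest) (updateAt-minimal m d id m≢d) (joinᶠ-ub rest-join m∈M)

    rest∧d≡𝟘 : rest ∧ d ≡ 𝟘
    rest∧d≡𝟘 = trans (meets-of-join others others≼ rest rest-join d∈M) (update-at id d 𝟘)

    ≼rest⇒∧d≡𝟘 : ∀ {y} → y ≼ rest → y ∧ d ≡ 𝟘
    ≼rest⇒∧d≡𝟘 y≼rest = ≼𝟘⇒≡𝟘 (subst (_ ≼_) rest∧d≡𝟘 (∧-monoˡ d y≼rest))

    split-off : d ≢ 𝟘 → rest ≢ 𝟘 → Split x d rest
    split-off d≢𝟘 rest≢𝟘 = record
      { a≢𝟘 = d≢𝟘 ; b≢𝟘 = rest≢𝟘 ; a≼x = component≼ d∈M ; b≼x = rest≼x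
      ; join-of-meets = λ y y≼x → join₂ (x∧y≼x y d) (x∧y≼x y rest) λ u y∧d≼u y∧rest≼u →
          joinᶠ-least-around d (join-of-meets y y≼x) y∧d≼u
            (λ m m∈M m≢d → ≼-trans (∧-mono ≼-refl (≼rest m∈M m≢d)) y∧rest≼u)
      ; meets-of-join = meets-of-join′ }
      where
      meets-of-join′ : ∀ y₁ y₂ z → y₁ ≼ d → y₂ ≼ rest → IsJoin₂ y₁ y₂ z → z ∧ d ≡ y₁ × z ∧ rest ≡ y₂
      meets-of-join′ y₁ y₂ z y₁≼d y₂≼rest z-join =
        z∧d≡y₁ , ≼-antisym z∧rest≼y₂ (∧-greatest (join₂-ubʳ z-join) y₂≼rest)
        where
        -- z is also the join over M of h, which is y₁ at d and the coordinates of y₂ elsewhere.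
        h : El → El
        h = (y₂ ∧_) [ d ≔ y₁ ]
        h-off : ∀ {m} → m ≢ d → h m ≡ y₂ ∧ m
        h-off {m} m≢d = updateAt-minimal m d (y₂ ∧_) m≢d
        h≼ : ∀ m → M m → h m ≼ m
        h≼ m _ = update-cases (_≼ m) (y₂ ∧_) d y₁ m (λ { refl → y₁≼d }) (λ _ → x∧y≼y y₂ m)
        h-join : IsJoinᶠ M h z
        h-join = joinᶠ
          (λ m _ → update-cases (_≼ z) (y₂ ∧_) d y₁ m
            (λ _ → join₂-ubˡ z-join) (λ _ → ≼-trans (x∧y≼x y₂ m) (join₂-ubʳ z-join)))
          (λ u h≼u → join₂-least z-join (subst (_≼ u) (update-at (y₂ ∧_) d y₁) (h≼u d d∈M))
            (joinᶠ-least-around d (join-of-meets y₂ (≼-trans y₂≼rest rest≼x))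
              (subst (_≼ u) (sym (≼rest⇒∧d≡𝟘 y₂≼rest)) (𝟘-min u))
              (λ m m∈M m≢d → subst (_≼ u) (h-off m≢d) (h≼u m m∈M))))
        z∧d≡y₁ : z ∧ d ≡ y₁
        z∧d≡y₁ = trans (meets-of-join h h≼ z h-join d∈M) (update-at (y₂ ∧_) d y₁)
        z∧rest≼y₂ : z ∧ rest ≼ y₂
        z∧rest≼y₂ = joinᶠ-least-around d (join-of-meets (z ∧ rest) (≼-trans (x∧y≼y z rest) rest≼x))
          (subst (_≼ y₂) (sym (≼rest⇒∧d≡𝟘 (x∧y≼y z rest))) (𝟘-min y₂))
          (λ m m∈M m≢d → ≼-trans (∧-monoˡ m (x∧y≼x z rest))
            (subst (_≼ y₂) (sym (trans (meets-of-join h h≼ z h-join m∈M) (h-off m≢d))) (x∧y≼x y₂ m)))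

  indecomposable∈decomposition : ∀ {x M} → Decomposition x M → Decidable M → (∀ {m} → M m → m ≢ 𝟘) →
                                 Indecomposable x → M x
  indecomposable∈decomposition {x} {M} D M? nonzero (x≢𝟘 , no-split) with any? M?
  ... | no empty = contradiction
    (≼𝟘⇒≡𝟘 (joinᶠ-least (join-of-meets x ≼-refl) (λ m m∈M → contradiction (m , m∈M) empty))) x≢𝟘
    where open Decomposition D
  ... | yes (d , d∈M) with rest ≟ 𝟘
    where open Rest D M? d∈M
  ... | no rest≢𝟘 = contradiction (d , rest , split-off (nonzero d∈M) rest≢𝟘) no-split
    where open Rest D M? d∈M
  ... | yes rest≡𝟘 = subst M (≼-antisym (component≼ d∈M) x≼d) d∈M
    where
    open Decomposition D
    open Rest D M? d∈M
    x≼d : x ≼ d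
    x≼d = joinᶠ-least-around d (join-of-meets x ≼-refl) (x∧y≼y x d)
      (λ m m∈M m≢d → contradiction (≼𝟘⇒≡𝟘 (subst (m ≼_) rest≡𝟘 (≼rest m∈M m≢d))) (nonzero m∈M))

  -- Building sets

  MaxBelow : Subset size → El → Pred El 0ℓ
  MaxBelow = IsMaxBelow P

  maxBelow? : ∀ B x → Decidable (MaxBelow B x)
  maxBelow? B x m = m ∈? B ×-dec m ≼? x ×-dec all? (λ z → z ∈? B →-dec z ≼? x →-dec m ≼? z →-dec z ≟ m)

  maxBelow-above : ∀ {B x b} → b ∈ B → b ≼ x → ∃[ m ] (MaxBelow B x m × b ≼ m)
  maxBelow-above {B} {x} b∈B b≼x with maximal-above (λ z → z ∈? B ×-dec z ≼? x) (b∈B , b≼x)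
  ... | m , b≼m , (m∈B , m≼x) , maximal = m , (m∈B , m≼x , λ z z∈B z≼x → maximal z (z∈B , z≼x)) , b≼m

  decomposition⇒building : ∀ {B x} → Decomposition x (MaxBelow B x) → BuildingAt P B x
  decomposition⇒building {B} {x} D = J , J-join , record
    { lands = λ G → joinᶠ-least (J-join G) (λ m m∈M → ≼-trans (proj₂ G m m∈M) (component≼ m∈M))
    ; mono = λ G G′ G≼G′ →
        joinᶠ-least (J-join G) (λ m m∈M → ≼-trans (G≼G′ m m∈M) (joinᶠ-ub (J-join G′) m∈M))
    ; reflect = λ G G′ JG≼JG′ m m∈M →
        subst₂ _≼_ (coordinate G m∈M) (coordinate G′ m∈M) (∧-monoˡ m JG≼JG′)
    ; onto = λ y y≼x → ((y ∧_) , λ m _ → x∧y≼y y m) , join-unique (J-join _) (join-of-meets y y≼x) }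
    where
    open Decomposition D
    J-exists : (G : ProdDom P B x) → ∃ (IsJoinᶠ (MaxBelow B x) (proj₁ G))
    J-exists (g , g≼) = joinᶠ-exists (maxBelow? B x) g (λ m m∈M → ≼-trans (g≼ m m∈M) (component≼ m∈M))
    J : ProdDom P B x → El
    J = proj₁ ∘ J-exists
    J-join : ∀ G → IsJoinᶠ (MaxBelow B x) (proj₁ G) (J G)
    J-join = proj₂ ∘ J-exists
    coordinate : ∀ G {m} → MaxBelow B x m → J G ∧ m ≡ proj₁ G m
    coordinate (g , g≼) = meets-of-join g g≼ _ (J-join (g , g≼))

  building⇒decomposition : ∀ {B x} → BuildingAt P B x → Decomposition x (MaxBelow B x)
  building⇒decomposition {B} {x} (J , J-join , iso) = record
    { component≼ = proj₁ ∘ proj₂ ; join-of-meets = join-of-meets′ ; meets-of-join = meets-of-join′ }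
    where
    open IsoOnto iso
    M : Pred El 0ℓ
    M = MaxBelow B x

    indicator : ∀ {m} v → v ≼ m → ProdDom P B x
    indicator {m} v v≼m =
      const 𝟘 [ m ≔ v ] , λ w _ → update-cases (_≼ w) (const 𝟘) m v w (λ { refl → v≼m }) (λ _ → 𝟘-min w)

    J-indicator : ∀ {m} v (v≼m : v ≼ m) → M m → J (indicator v v≼m) ≡ v
    J-indicator v v≼m m∈M = join-unique (J-join (indicator v v≼m)) (joinᶠ-indicator v m∈M)

    meets-of-join′ : MeetsOfJoin M
    meets-of-join′ g g≼ z z-join {m} m∈M with join-unique z-join (J-join (g , g≼))
    ... | refl with onto (z ∧ m) (≼-trans (x∧y≼y z m) (proj₁ (proj₂ m∈M)))
    ... | (h , h≼) , Jh≡z∧m =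
      ≼-antisym (subst₂ _≼_ Jh≡z∧m (J-indicator (g m) (g≼ m m∈M) m∈M) (mono _ _ h≼δ))
                (∧-greatest (joinᶠ-ub z-join m∈M) (g≼ m m∈M))
      where
      h≼g : ∀ w → M w → h w ≼ g w
      h≼g = reflect _ _ (subst (_≼ z) (sym Jh≡z∧m) (x∧y≼x z m))
      h≼ε : ∀ w → M w → h w ≼ (const 𝟘 [ m ≔ m ]) w
      h≼ε = reflect _ (indicator m ≼-refl)
        (subst₂ _≼_ (sym Jh≡z∧m) (sym (J-indicator m ≼-refl m∈M)) (x∧y≼y z m))
      h≼δ : ∀ w → M w → h w ≼ (const 𝟘 [ m ≔ g m ]) w
      h≼δ w w∈M = update-cases (h w ≼_) (const 𝟘) m (g m) w (λ { refl → h≼g w w∈M })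
        (λ w≢m → subst (h w ≼_) (updateAt-minimal w m (const 𝟘) w≢m) (h≼ε w w∈M))

    join-of-meets′ : JoinOfMeets x M
    join-of-meets′ y y≼x with onto y y≼x
    ... | (h , h≼) , refl = joinᶠ (λ m _ → x∧y≼x _ m) λ u ub → joinᶠ-least h-join λ m m∈M →
      subst (_≼ u) (meets-of-join′ h h≼ _ h-join m∈M) (ub m m∈M)
      where
      h-join : IsJoinᶠ M h (J (h , h≼))
      h-join = J-join (h , h≼)

  building-at-member : ∀ {B x} → x ∈ B → BuildingAt P B x
  building-at-member x∈B = decomposition⇒building (singleton-decomposition
    (λ (_ , m≼x , maximal) → sym (maximal _ x∈B ≼-refl m≼x))
    (x∈B , ≼-refl , λ _ _ z≼x x≼z → ≼-antisym z≼x x≼z))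

  building⇒indecomposable∈ : ∀ {B x} → IsBuildingSet P B → Indecomposable x → x ∈ B
  building⇒indecomposable∈ {B} {x} (𝟘∉B , building) x-ind@(x≢𝟘 , _) = proj₁
    (indecomposable∈decomposition (building⇒decomposition (building x x≢𝟘)) (maxBelow? B x)
      (λ (m∈B , _) m≡𝟘 → 𝟘∉B (subst (_∈ B) m≡𝟘 m∈B)) x-ind)

  building-criterion : ∀ {B x} → x ≢ 𝟘 → (∀ {c} → Indecomposable c → c ≼ x → c ∈ B) →
                       (∀ {m m′} → MaxBelow B x m → MaxBelow B x m′ → m ≢ m′ → m ∧ m′ ≡ 𝟘) →
                       Decomposition x (MaxBelow B x)
  building-criterion {B} {x} x≢𝟘 indecomposables∈B disjoint = record
    { component≼ = proj₁ ∘ proj₂ ; join-of-meets = join-of-meets′ ; meets-of-join = meets-of-join′ }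
    where
    M : Pred El 0ℓ
    M = MaxBelow B x
    module C = Decomposition (components-decomposition x≢𝟘)

    covering : ∀ {d} → Component x d → ∃[ m ] (M m × d ≼ m)
    covering ((d-ind , d≼x) , _) = maxBelow-above (indecomposables∈B d-ind d≼x) d≼x

    join-of-meets′ : JoinOfMeets x M
    join-of-meets′ y y≼x = joinᶠ (λ m _ → x∧y≼x y m) λ u ub → joinᶠ-least (C.join-of-meets y y≼x) λ d d∈C →
      let m , m∈M , d≼m = covering d∈C in ≼-trans (∧-mono ≼-refl d≼m) (ub m m∈M)

    meets-of-join′ : MeetsOfJoin M
    meets-of-join′ g g≼ z z-join {m} m∈M =
      ≼-antisym (≼-via-indecomposables below-gm) (∧-greatest (joinᶠ-ub z-join m∈M) (g≼ m m∈M))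
      where
      trace-exists : ∀ d → ∃ (IsJoinᶠ M (λ m′ → g m′ ∧ d))
      trace-exists d = joinᶠ-exists (maxBelow? B x) (λ m′ → g m′ ∧ d) (λ _ _ → x∧y≼y _ d)
      trace : El → El
      trace = proj₁ ∘ trace-exists
      trace-join : ∀ d → IsJoinᶠ M (λ m′ → g m′ ∧ d) (trace d)
      trace-join = proj₂ ∘ trace-exists
      z-join-of-traces : IsJoinᶠ (Component x) trace z
      z-join-of-traces = joinᶠ
        (λ d _ → joinᶠ-least (trace-join d) (λ m′ m′∈M → ≼-trans (x∧y≼x _ d) (joinᶠ-ub z-join m′∈M)))
        (λ u ub → joinᶠ-least z-join (λ m′ m′∈M →
          joinᶠ-least (C.join-of-meets (g m′) (≼-trans (g≼ m′ m′∈M) (proj₁ (proj₂ m′∈M))))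
            (λ d d∈C → ≼-trans (joinᶠ-ub (trace-join d) m′∈M) (ub d d∈C))))
      trace≼ : ∀ d → Component x d → trace d ≼ d
      trace≼ d _ = joinᶠ-least (trace-join d) (λ _ _ → x∧y≼y _ d)
      -- z ∧ d is computed in the decomposition of x into its components, where the traces
      -- g m″ ∧ d with m″ ≢ m vanish by disjointness.
      below-gm : ∀ c → Indecomposable c → c ≼ z ∧ m → c ≼ g m
      below-gm c c-ind c≼z∧m
        with component-above c-ind (≼-trans c≼z∧m (≼-trans (x∧y≼y z m) (proj₁ (proj₂ m∈M))))
      ... | d , d∈C , c≼d with covering d∈C
      ... | m′ , m′∈M , d≼m′ with m′ ≟ m
      ... | no m′≢m = contradiction (≼𝟘⇒≡𝟘 (subst (c ≼_) (disjoint m′∈M m∈M m′≢m)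
                        (∧-greatest (≼-trans c≼d d≼m′) (≼-trans c≼z∧m (x∧y≼y z m))))) (proj₁ c-ind)
      ... | yes refl = begin
        c        ≤⟨ ∧-greatest (≼-trans c≼z∧m (x∧y≼x z m)) c≼d ⟩
        z ∧ d    ≡⟨ C.meets-of-join trace trace≼ z z-join-of-traces d∈C ⟩
        trace d  ≤⟨ joinᶠ-least-around m (trace-join d) (x∧y≼x (g m) d) (λ m″ m″∈M m″≢m →
                      subst (_≼ g m) (sym (≼𝟘⇒≡𝟘 (subst (_ ≼_) (disjoint m″∈M m∈M m″≢m)
                                                       (∧-mono (g≼ m″ m″∈M) d≼m′))))
                        (𝟘-min (g m))) ⟩
        g m      ∎
        where open ≼-Reasoning

module Embedding (L K : FinMSL) (f : Fin (FinMSL.size L) → Fin (FinMSL.size K))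
                 (embedding : IsMSLEmbedding L K f) (consistent : IsConsistent L K f) where
  module L = Theory L
  module K = Theory K
  open IsMSLEmbedding embedding

  f-injective : ∀ {x y} → f x ≡ f y → x ≡ y
  f-injective fx≡fy =
    L.≼-antisym (reflect _ _ (K.≼-reflexive fx≡fy)) (reflect _ _ (K.≼-reflexive (sym fx≡fy)))

  indecomposable-preimage : ∀ {x c} → x ≢ L.𝟘 → K.Indecomposable c → c K.≼ f x →
                            ∃[ y ] (f y ≡ c × L.Indecomposable y × y L.≼ x)
  indecomposable-preimage x≢𝟘 c-ind c≼fx with consistent _ x≢𝟘 _ (K.indecomposable⇒InI c-ind) c≼fx
  ... | y , fy≡c , y∈I , y≼x = y , fy≡c , L.InI⇒indecomposable y∈I , y≼x

  f𝟘≡𝟘 : ∀ {x} → x ≢ L.𝟘 → f L.𝟘 ≡ K.𝟘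
  f𝟘≡𝟘 {x} x≢𝟘 = K.≼𝟘⇒≡𝟘 (K.≼-via-indecomposables λ c c-ind c≼f𝟘 →
    let y , fy≡c , (y≢𝟘 , _) , _ =
          indecomposable-preimage x≢𝟘 c-ind (K.≼-trans c≼f𝟘 (mono _ _ (L.𝟘-min x)))
    in contradiction (L.≼𝟘⇒≡𝟘 (reflect _ _ (subst (K._≼ f L.𝟘) (sym fy≡c) c≼f𝟘))) y≢𝟘)

  f≢𝟘 : ∀ {x} → x ≢ L.𝟘 → f x ≢ K.𝟘
  f≢𝟘 x≢𝟘 fx≡𝟘 = x≢𝟘 (f-injective (trans fx≡𝟘 (sym (f𝟘≡𝟘 x≢𝟘))))

  bound≢𝟘 : ∀ {x k l} → x ≢ L.𝟘 → k ≢ K.𝟘 → k K.≼ f l → l ≢ L.𝟘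
  bound≢𝟘 x≢𝟘 k≢𝟘 k≼fl l≡𝟘 = k≢𝟘 (K.≼𝟘⇒≡𝟘 (subst (_ K.≼_) (trans (cong f l≡𝟘) (f𝟘≡𝟘 x≢𝟘)) k≼fl))

  Above : K.El → Pred L.El 0ℓ
  Above k l = k K.≼ f l

  least-above : ∀ {k l} → k K.≼ f l → ∃ (L.IsLeast (Above k))
  least-above {k} = L.least-exists (λ l → k K.≼? f l)
    (λ {a} {b} k≼fa k≼fb → subst (k K.≼_) (sym (pres-∧ a b)) (K.∧-greatest k≼fa k≼fb))

  module Restriction (B : Subset (FinMSL.size K)) (B-building : IsBuildingSet K B)
                     (I⊆B : ContainsIL L K f B) where

    B≢𝟘 : ∀ {k} → k ∈ B → k ≢ K.𝟘
    B≢𝟘 k∈B k≡𝟘 = proj₁ B-building (subst (_∈ B) k≡𝟘 k∈B)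

    maxBelow-disjoint : ∀ {x m m′} → x ≢ K.𝟘 → K.MaxBelow B x m → K.MaxBelow B x m′ → m ≢ m′ →
                        m K.∧ m′ ≡ K.𝟘
    maxBelow-disjoint x≢𝟘 = K.decomposition-disjoint (K.building⇒decomposition (proj₂ B-building _ x≢𝟘))

    module MaxBelowImage {l m} (l≢𝟘 : l ≢ L.𝟘) (m∈M : K.MaxBelow B (f l) m) where
      m≼fl : m K.≼ f l
      m≼fl = proj₁ (proj₂ m∈M)

      t : L.El
      t = proj₁ (least-above m≼fl)

      t-least : L.IsLeast (Above m) t
      t-least = proj₂ (least-above m≼fl)

      m≼ft : m K.≼ f t
      m≼ft = proj₁ t-least

      t≼l : t L.≼ l
      t≼l = proj₂ t-least l m≼fl

      t≢𝟘 : t ≢ L.𝟘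
      t≢𝟘 = bound≢𝟘 l≢𝟘 (B≢𝟘 (proj₁ m∈M)) m≼ft

      -- If f d lay below another maximal m′, then m ≼ f rest for the join rest of the other
      -- components of t, so t ≼ rest and d ≡ 𝟘.
      component-below-m : ∀ {d} → L.Component t d → f d K.≼ m
      component-below-m {d} d∈C@((d-ind@(d≢𝟘 , _) , d≼t) , _)
        with K.maxBelow-above {B} (I⊆B d (L.indecomposable⇒InI d-ind)) (mono _ _ (L.≼-trans d≼t t≼l))
      ... | m′ , m′∈M , fd≼m′ with m′ ≟ m
      ... | yes refl = fd≼m′
      ... | no m′≢m =
        contradiction (trans (sym (L.x≼y⇒x∧y≡x L.≼-refl)) (≼rest⇒∧d≡𝟘 (L.≼-trans d≼t t≼rest))) d≢𝟘
        where
        open L.Rest (L.components-decomposition t≢𝟘) (L.component? t) d∈C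
        m≼f-rest : m K.≼ f rest
        m≼f-rest = K.≼-via-indecomposables λ c c-ind c≼m →
          let y , fy≡c , y-ind , y≼t = indecomposable-preimage t≢𝟘 c-ind (K.≼-trans c≼m m≼ft)
              d′ , d′∈C , y≼d′ = L.component-above y-ind y≼t
          in case d′ ≟ d of λ
            { (yes refl) → contradiction
                (K.≼𝟘⇒≡𝟘 (subst (c K.≼_) (maxBelow-disjoint (f≢𝟘 l≢𝟘) m′∈M m∈M m′≢m)
                  (K.∧-greatest (subst (K._≼ m′) fy≡c (K.≼-trans (mono _ _ y≼d′) fd≼m′)) c≼m)))
                (proj₁ c-ind)
            ; (no d′≢d) → subst (K._≼ f rest) fy≡c (mono _ _ (L.≼-trans y≼d′ (≼rest d′∈C d′≢d))) }
        t≼rest : t L.≼ rest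
        t≼rest = proj₂ t-least rest m≼f-rest

      ft≼m : f t K.≼ m
      ft≼m = K.≼-via-indecomposables λ e e-ind e≼ft →
        let y , fy≡e , y-ind , y≼t = indecomposable-preimage t≢𝟘 e-ind e≼ft
            d , d∈C , y≼d = L.component-above y-ind y≼t
        in subst (K._≼ m) fy≡e (K.≼-trans (mono _ _ y≼d) (component-below-m d∈C))

      ft≡m : f t ≡ m
      ft≡m = K.≼-antisym ft≼m m≼ft

    least-above∈B : ∀ {w z} → z ≢ L.𝟘 → w ∈ B → L.IsLeast (Above w) z → f z ∈ B
    least-above∈B {w} {z} z≢𝟘 w∈B (w≼fz , z-least) with K.maxBelow-above w∈B w≼fz
    ... | m , m∈M , w≼m = subst (_∈ B) (trans (sym ft≡m) (cong f t≡z)) (proj₁ m∈M)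
      where
      open MaxBelowImage z≢𝟘 m∈M
      t≡z : t ≡ z
      t≡z = L.≼-antisym t≼l (z-least t (K.≼-trans w≼m m≼ft))

    module Restricted (B′ : Subset (FinMSL.size L)) (restriction : IsRestriction L K f B B′) where

      ∈B′⇒ : ∀ {x} → x ∈ B′ → x ≢ L.𝟘 × f x ∈ B
      ∈B′⇒ = proj₁ (restriction _)

      ⇒∈B′ : ∀ {x} → x ≢ L.𝟘 → f x ∈ B → x ∈ B′
      ⇒∈B′ x≢𝟘 fx∈B = proj₂ (restriction _) (x≢𝟘 , fx∈B)

      restriction-building : IsBuildingSet L B′
      restriction-building = (λ 𝟘∈B′ → proj₁ (∈B′⇒ 𝟘∈B′) refl) , λ l l≢𝟘 →
        L.decomposition⇒building (L.building-criterion l≢𝟘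
          (λ c-ind@(c≢𝟘 , _) _ → ⇒∈B′ c≢𝟘 (I⊆B _ (L.indecomposable⇒InI c-ind)))
          (disjoint l≢𝟘))
        where
        disjoint : ∀ {l y y′} → l ≢ L.𝟘 → L.MaxBelow B′ l y → L.MaxBelow B′ l y′ → y ≢ y′ →
                   y L.∧ y′ ≡ L.𝟘
        disjoint {l} {y} {y′} l≢𝟘 (y∈B′ , y≼l , y-max) (y′∈B′ , y′≼l , y′-max) y≢y′
          with K.maxBelow-above (proj₂ (∈B′⇒ y∈B′)) (mono _ _ y≼l)
             | K.maxBelow-above (proj₂ (∈B′⇒ y′∈B′)) (mono _ _ y′≼l)
        ... | m , m∈M , fy≼m | m′ , m′∈M , fy′≼m′ with m ≟ m′
        ... | no m≢m′ = L.≼𝟘⇒≡𝟘 (reflect _ _ (begin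
          f (y L.∧ y′)    ≡⟨ pres-∧ y y′ ⟩
          f y K.∧ f y′    ≤⟨ K.∧-mono fy≼m fy′≼m′ ⟩
          m K.∧ m′        ≡⟨ maxBelow-disjoint (f≢𝟘 l≢𝟘) m∈M m′∈M m≢m′ ⟩
          K.𝟘             ≡⟨ f𝟘≡𝟘 l≢𝟘 ⟨
          f L.𝟘           ∎))
          where open K.≼-Reasoning
        ... | yes refl = contradiction (trans (sym (y-max t t∈B′ t≼l y≼t)) (y′-max t t∈B′ t≼l y′≼t)) y≢y′
          where
          open MaxBelowImage l≢𝟘 m∈M
          t∈B′ : t ∈ B′
          t∈B′ = ⇒∈B′ t≢𝟘 (subst (_∈ B) (sym ft≡m) (proj₁ m∈M))
          y≼t : y L.≼ t
          y≼t = reflect _ _ (subst (f y K.≼_) (sym ft≡m) fy≼m)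
          y′≼t : y′ L.≼ t
          y′≼t = reflect _ _ (subst (f y′ K.≼_) (sym ft≡m) fy′≼m′)

      restriction-nested : ∀ {N M} → IsNested L B′ N → IsImage L K f N M → IsNested K B M
      restriction-nested {N} {M} (N⊆B′ , N-nested) image = M⊆B , antichain-join
        where
        preimage : ∀ {k} → k ∈ M → ∃[ x ] (x ∈ N × f x ≡ k)
        preimage k∈M = proj₁ (image _) k∈M

        M⊆B : M ⊆ B
        M⊆B k∈M with preimage k∈M
        ... | x , x∈N , refl = proj₂ (∈B′⇒ (N⊆B′ x∈N))

        antichain-join : ∀ S → S ⊆ M → 2 ≤ ∣ S ∣ → (∀ a b → a ∈ S → b ∈ S → a K.≼ b → a ≡ b) →
                         ∃[ w ] (IsJoin K (_∈ S) w × w ∉ B)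
        antichain-join S S⊆M 2≤∣S∣ S-antichain = w , w-join , w∉B
          where
          S′ : Subset (FinMSL.size L)
          S′ = subset (λ x → f x ∈? S)

          S′⇒S : ∀ {x} → x ∈ S′ → f x ∈ S
          S′⇒S = ∈-subset⁻ (λ x → f x ∈? S)

          S⇒S′ : ∀ {k} → k ∈ S → ∃[ x ] (x ∈ S′ × f x ≡ k)
          S⇒S′ k∈S with preimage (S⊆M k∈S)
          ... | x , _ , refl = x , ∈-subset⁺ (λ x → f x ∈? S) k∈S , refl

          S′⊆N : S′ ⊆ N
          S′⊆N x∈S′ with preimage (S⊆M (S′⇒S x∈S′))
          ... | x′ , x′∈N , fx′≡fx = subst (_∈ N) (f-injective fx′≡fx) x′∈N

          2≤∣S′∣ : 2 ≤ ∣ S′ ∣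
          2≤∣S′∣ with 2≤∣∣⇒distinct S 2≤∣S∣
          ... | a , b , a∈S , b∈S , a≢b with S⇒S′ a∈S | S⇒S′ b∈S
          ... | x , x∈S′ , refl | y , y∈S′ , refl = distinct⇒2≤∣∣ x∈S′ y∈S′ (a≢b ∘ cong f)

          S′-antichain : ∀ x y → x ∈ S′ → y ∈ S′ → x L.≼ y → x ≡ y
          S′-antichain x y x∈S′ y∈S′ x≼y = f-injective (S-antichain _ _ (S′⇒S x∈S′) (S′⇒S y∈S′) (mono _ _ x≼y))

          z-exists : ∃[ z ] (IsJoin L (_∈ S′) z × z ∉ B′)
          z-exists = N-nested S′ S′⊆N 2≤∣S′∣ S′-antichain

          z : L.El
          z = proj₁ z-exists

          z-join : IsJoin L (_∈ S′) z
          z-join = proj₁ (proj₂ z-exists)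

          z≢𝟘 : z ≢ L.𝟘
          z≢𝟘 z≡𝟘 with 2≤∣∣⇒distinct S′ 2≤∣S′∣
          ... | x , _ , x∈S′ , _ = proj₁ (∈B′⇒ (N⊆B′ (S′⊆N x∈S′)))
                                     (L.≼𝟘⇒≡𝟘 (subst (x L.≼_) z≡𝟘 (proj₁ z-join x x∈S′)))

          fz-ub : ∀ k → k ∈ S → k K.≼ f z
          fz-ub k k∈S with S⇒S′ k∈S
          ... | x , x∈S′ , refl = mono _ _ (proj₁ z-join x x∈S′)

          w-exists : ∃ (IsJoin K (_∈ S))
          w-exists = K.join-exists (_∈? S) fz-ub

          w : K.El
          w = proj₁ w-exists

          w-join : IsJoin K (_∈ S) w
          w-join = proj₂ w-exists

          z-least-above-w : L.IsLeast (Above w) z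
          z-least-above-w = proj₂ w-join (f z) fz-ub , λ t w≼ft → proj₂ z-join t λ x x∈S′ →
            reflect _ _ (K.≼-trans (proj₁ w-join (f x) (S′⇒S x∈S′)) w≼ft)

          w∉B : w ∉ B
          w∉B w∈B = proj₂ (proj₂ z-exists) (⇒∈B′ z≢𝟘 (least-above∈B z≢𝟘 w∈B z-least-above-w))

  module Extension (B′ : Subset (FinMSL.size L)) (B′-building : IsBuildingSet L B′) where

    Extends : Subset (FinMSL.size K) → Set₁
    Extends B = IsBuildingSet K B × ContainsIL L K f B × IsRestriction L K f B B′

    B′≢𝟘 : ∀ {x} → x ∈ B′ → x ≢ L.𝟘
    B′≢𝟘 x∈B′ x≡𝟘 = proj₁ B′-building (subst (_∈ B′) x≡𝟘 x∈B′)

    -- Needed separately: for L = {𝟘} nothing forces f 𝟘 = 𝟘.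
    trivial-extension : (∀ x → x ≡ L.𝟘) → ∃ Extends
    trivial-extension trivial = B , (𝟘∉B , λ _ x≢𝟘 → K.building-at-member (∈-subset⁺ nonzero? x≢𝟘)) ,
      (λ x x∈I → contradiction (trivial x) (proj₁ x∈I)) ,
      (λ x → (λ x∈B′ → contradiction (trivial x) (B′≢𝟘 x∈B′)) ,
             (λ (x≢𝟘 , _) → contradiction (trivial x) x≢𝟘))
      where
      nonzero? : Decidable (_≢ K.𝟘)
      nonzero? k = ¬? (k ≟ K.𝟘)

      B : Subset (FinMSL.size K)
      B = subset nonzero?

      𝟘∉B : K.𝟘 ∉ B
      𝟘∉B 𝟘∈B = ∈-subset⁻ nonzero? 𝟘∈B refl

    module NonTrivial {x₀} (x₀≢𝟘 : x₀ ≢ L.𝟘) where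

      InB : K.El → Set
      InB k = k ≢ K.𝟘 × ((∀ l → ¬ Above k l) ⊎ ∃[ s ] (L.IsLeast (Above k) s × s ∈ B′))

      inB? : Decidable InB
      inB? k = ¬? (k ≟ K.𝟘) ×-dec (all? (λ l → ¬? (k K.≼? f l)) ⊎-dec
        any? (λ s → (k K.≼? f s ×-dec all? (λ l → k K.≼? f l →-dec s L.≼? l)) ×-dec s ∈? B′))

      B : Subset (FinMSL.size K)
      B = subset inB?

      B≢𝟘 : ∀ {k} → k ∈ B → k ≢ K.𝟘
      B≢𝟘 = proj₁ ∘ ∈-subset⁻ inB?

      least-outside : ∀ {k} → k ∉ B → k ≢ K.𝟘 → ∃[ s ] (L.IsLeast (Above k) s × s ∉ B′)
      least-outside {k} k∉B k≢𝟘 with any? (λ l → k K.≼? f l)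
      ... | no unbounded =
        contradiction (∈-subset⁺ inB? (k≢𝟘 , inj₁ (λ l k≼fl → unbounded (l , k≼fl)))) k∉B
      ... | yes (l , k≼fl) with least-above k≼fl
      ... | s , s-least with s ∈? B′
      ... | yes s∈B′ = contradiction (∈-subset⁺ inB? (k≢𝟘 , inj₂ (s , s-least , s∈B′))) k∉B
      ... | no s∉B′ = s , s-least , s∉B′

      least-inside : ∀ {k l} → k ∈ B → k K.≼ f l → ∃[ s ] (L.IsLeast (Above k) s × s ∈ B′)
      least-inside {l = l} k∈B k≼fl with ∈-subset⁻ inB? k∈B
      ... | _ , inj₁ unbounded = contradiction k≼fl (unbounded l)
      ... | _ , inj₂ s-least∈B′ = s-least∈B′

      f∈B : ∀ {x} → x ∈ B′ → f x ∈ B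
      f∈B {x} x∈B′ = ∈-subset⁺ inB? (f≢𝟘 (B′≢𝟘 x∈B′) , inj₂ (x , (K.≼-refl , λ l → reflect _ _) , x∈B′))

      maxBelow-member : ∀ {x m} → x ∈ B → K.MaxBelow B x m → m ≡ x
      maxBelow-member x∈B (_ , m≼x , m-max) = sym (m-max _ x∈B K.≼-refl m≼x)

      Disjoint : K.El → Set
      Disjoint x = x ≢ K.𝟘 → ∀ {b b′} → K.MaxBelow B x b → K.MaxBelow B x b′ → b ≢ b′ → b K.∧ b′ ≡ K.𝟘

      -- If x ∉ B, its least bound s in L lies outside B′. Each maximal b lies below f y for a
      -- maximal y of B′ below s; distinct y are disjoint, and a common y lets us recurse on
      -- x ∧ f y ≺ x.
      maxBelow-disjoint : ∀ x → Disjoint x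
      maxBelow-disjoint = K.≺-rec Disjoint step
        where
        step : ∀ x → (∀ {x′} → x′ K.≺ x → Disjoint x′) → Disjoint x
        step x rec x≢𝟘 {b} {b′} b∈M b′∈M b≢b′ with x ∈? B
        ... | yes x∈B =
          contradiction (trans (maxBelow-member x∈B b∈M) (sym (maxBelow-member x∈B b′∈M))) b≢b′
        ... | no x∉B with least-outside x∉B x≢𝟘
        ... | s , (x≼fs , s-least) , s∉B′ = by-lifts (lift b∈M) (lift b′∈M)
          where
          s≢𝟘 : s ≢ L.𝟘
          s≢𝟘 = bound≢𝟘 x₀≢𝟘 x≢𝟘 x≼fs

          lift : ∀ {c} → K.MaxBelow B x c → ∃[ y ] (L.MaxBelow B′ s y × c K.≼ f y)
          lift (c∈B , c≼x , _) with least-inside c∈B (K.≼-trans c≼x x≼fs)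
          ... | t , (c≼ft , t-least) , t∈B′ with L.maxBelow-above t∈B′ (t-least s (K.≼-trans c≼x x≼fs))
          ... | y , y∈M′ , t≼y = y , y∈M′ , K.≼-trans c≼ft (mono _ _ t≼y)

          restrict : ∀ {c y} → K.MaxBelow B x c → c K.≼ f y → K.MaxBelow B (x K.∧ f y) c
          restrict {y = y} (c∈B , c≼x , c-max) c≼fy =
            c∈B , K.∧-greatest c≼x c≼fy ,
            λ z z∈B z≼x∧fy → c-max z z∈B (K.≼-trans z≼x∧fy (K.x∧y≼x x (f y)))

          by-lifts : ∃[ y ] (L.MaxBelow B′ s y × b K.≼ f y) →
                     ∃[ y′ ] (L.MaxBelow B′ s y′ × b′ K.≼ f y′) → b K.∧ b′ ≡ K.𝟘
          by-lifts (y , y∈M′ , b≼fy) (y′ , y′∈M′ , b′≼fy′) with y ≟ y′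
          ... | no y≢y′ = K.≼𝟘⇒≡𝟘 (begin
            b K.∧ b′        ≤⟨ K.∧-mono b≼fy b′≼fy′ ⟩
            f y K.∧ f y′    ≡⟨ pres-∧ y y′ ⟨
            f (y L.∧ y′)    ≡⟨ cong f (L.decomposition-disjoint
                                 (L.building⇒decomposition (proj₂ B′-building s s≢𝟘)) y∈M′ y′∈M′ y≢y′) ⟩
            f L.𝟘           ≡⟨ f𝟘≡𝟘 x₀≢𝟘 ⟩
            K.𝟘             ∎)
            where open K.≼-Reasoning
          ... | yes refl =
            rec (K.x∧y≼x x (f y) , x∧fy≢x) x∧fy≢𝟘 (restrict b∈M b≼fy) (restrict b′∈M b′≼fy′) b≢b′
            where
            x∧fy≢x : x K.∧ f y ≢ x
            x∧fy≢x x∧fy≡x = s∉B′ (subst (_∈ B′) (L.≼-antisym (proj₁ (proj₂ y∈M′))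
              (s-least y (subst (K._≼ f y) x∧fy≡x (K.x∧y≼y x (f y))))) (proj₁ y∈M′))
            x∧fy≢𝟘 : x K.∧ f y ≢ K.𝟘
            x∧fy≢𝟘 x∧fy≡𝟘 = B≢𝟘 (proj₁ b∈M)
              (K.≼𝟘⇒≡𝟘 (subst (b K.≼_) x∧fy≡𝟘 (K.∧-greatest (proj₁ (proj₂ b∈M)) b≼fy)))

      indecomposable∈B : ∀ {c} → K.Indecomposable c → c ∈ B
      indecomposable∈B {c} c-ind@(c≢𝟘 , _) with any? (λ l → c K.≼? f l)
      ... | no unbounded = ∈-subset⁺ inB? (c≢𝟘 , inj₁ (λ l c≼fl → unbounded (l , c≼fl)))
      ... | yes (l , c≼fl) =
        let y , fy≡c , y-ind , _ = indecomposable-preimage (bound≢𝟘 x₀≢𝟘 c≢𝟘 c≼fl) c-ind c≼fl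
        in subst (_∈ B) fy≡c (f∈B (L.building⇒indecomposable∈ B′-building y-ind))

      extension : Extends B
      extension = B-building , I⊆B , restriction
        where
        B-building : IsBuildingSet K B
        B-building = (λ 𝟘∈B → B≢𝟘 𝟘∈B refl) , λ x x≢𝟘 →
          K.decomposition⇒building
            (K.building-criterion x≢𝟘 (λ c-ind _ → indecomposable∈B c-ind) (maxBelow-disjoint x x≢𝟘))

        I⊆B : ContainsIL L K f B
        I⊆B x x∈I = f∈B (L.building⇒indecomposable∈ B′-building (L.InI⇒indecomposable x∈I))

        restriction : IsRestriction L K f B B′
        restriction x = (λ x∈B′ → B′≢𝟘 x∈B′ , f∈B x∈B′) , λ (_ , fx∈B) → from-B fx∈B
          where
          from-B : f x ∈ B → x ∈ B′
          from-B fx∈B with ∈-subset⁻ inB? fx∈B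
          ... | _ , inj₁ unbounded = contradiction K.≼-refl (unbounded x)
          ... | _ , inj₂ (s , (fx≼fs , s-least) , s∈B′) =
            subst (_∈ B′) (L.≼-antisym (s-least x K.≼-refl) (reflect _ _ fx≼fs)) s∈B′

    extension : ∃ Extends
    extension with any? (λ x → ¬? (x ≟ L.𝟘))
    ... | yes (x₀ , x₀≢𝟘) = _ , NonTrivial.extension x₀≢𝟘
    ... | no trivial = trivial-extension (λ x → decidable-stable (x ≟ L.𝟘) (λ x≢𝟘 → trivial (x , x≢𝟘)))

theorem4p5 : (L K : FinMSL) (f : Fin (FinMSL.size L) → Fin (FinMSL.size K)) →
    IsMSLEmbedding L K f → IsConsistent L K f →
    -- (1) 𝔹(L) = { B ∩ L⁺ : B ∈ 𝔹(K), I(L) ⊆ B }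
    ((B' : Subset (FinMSL.size L)) →
       (IsBuildingSet L B' →
          Σ[ B ∈ Subset (FinMSL.size K) ]
            (IsBuildingSet K B × ContainsIL L K f B × IsRestriction L K f B B'))
       × ((Σ[ B ∈ Subset (FinMSL.size K) ]
            (IsBuildingSet K B × ContainsIL L K f B × IsRestriction L K f B B'))
          → IsBuildingSet L B'))
    ×
    -- (2) B ∈ 𝔹(K), I(L) ⊆ B  ⇒  𝒩_L(B ∩ L⁺) ⊆ 𝒩_K(B)
    ((B : Subset (FinMSL.size K)) → IsBuildingSet K B → ContainsIL L K f B →
       (B' : Subset (FinMSL.size L)) → IsRestriction L K f B B' →
       (N : Subset (FinMSL.size L)) → IsNested L B' N →
       (M : Subset (FinMSL.size K)) → IsImage L K f N M →
       IsNested K B M)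
theorem4p5 L K f embedding consistent =
  (λ B′ → Extension.extension B′ , λ (B , B-building , I⊆B , restriction) →
            Restriction.Restricted.restriction-building B B-building I⊆B B′ restriction) ,
  λ B B-building I⊆B B′ restriction N N-nested M image →
    Restriction.Restricted.restriction-nested B B-building I⊆B B′ restriction N-nested image
  where open Embedding L K f embedding consistent
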